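{- Let $q\ge1$ and $0\le r_1\le\cdots\le r_q$ be integers, let $n,m$ be non-negative integers and $p$ a prime with $p\nmid m$. Then $$x^{r_q}\sum_{k=1}^{p-1}\frac{F_{n+k}(x;\mathbf{r}_q)}{(-m)^k}\equiv(-m)^n(-m)_{r_1}\cdots(-m)_{r_q}\left(\mathcal{F}_{p-1}(x;m,0)-1\right)\pmod{p\mathbb{Z}_p[x]}.$$ In particular, for $q=1$ and $r_1=r$, $$x^r\sum_{k=1}^{p-1}\frac{\mathcal{F}_{n+k}(x;r,r)}{(-m)^k}\equiv(-m)^n(-m)_r\left(\mathcal{F}_{p-1}(x;m,0)-1\right)\pmod{p\mathbb{Z}_p[x]}.$$
   Context: $(\alpha)_j=\alpha(\alpha-1)\cdots(\alpha-j+1)$ for $j\ge1$, $(\alpha)_0=1$. ${n\brace k}_r$ is the $r$-Stirling number of the second kind (partitions of $\{1,\dots,n\}$ into $k$ nonempty blocks with $1,\dots,r$ in distinct blocks), and $\mathcal{F}_n(x;r,s)=\sum_{k=0}^n {n+r\brace k+r}_r (k+s)!\,x^k$. For $\mathbf{r}_q=(r_1,\dots,r_q)$ write $|\mathbf{r}_q|=r_1+\cdots+r_q$ and $|\mathbf{r}_{q-1}|=r_1+\cdots+r_{q-1}$. The $(r_1,\dots,r_q)$-Stirling number ${N\brace k}_{\mathbf{r}_q}$, for $N=n+|\mathbf{r}_q|$, is the number of partitions of $\{1,\dots,N\}$ into $k$ nonempty blocks such that, for fixed pairwise disjoint subsets $R_1,\dots,R_q$ of $\{1,\dots,N\}$ with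 $|R_i|=r_i$, the elements of each $R_i$ lie in distinct blocks. Define $F_n(x;\mathbf{r}_q)=\sum_{j=0}^{n+|\mathbf{r}_{q-1}|}{n+|\mathbf{r}_q|\brace j+r_q}_{\mathbf{r}_q}(j+r_q)!\,x^j$. $\mathbb{Z}_p$ is the ring of $p$-adic integers ($1/(-m)^k\in\mathbb{Z}_p$), and congruence modulo $p\mathbb{Z}_p[x]$ means coefficientwise congruence modulo $p$. -}

module Defs where

open import Data.Bool using (Bool; true; false; _∧_; if_then_else_; not)
open import Data.Nat as ℕ using (ℕ; zero; suc; _∸_; _≡ᵇ_; _≤ᵇ_; _<ᵇ_)
open import Data.Nat using (_!)
open import Data.Nat.Divisibility using (_∣_)
open import Data.Integer as ℤ using (ℤ; +_)
open import Data.Rational.Unnormalised as Q using (ℚᵘ; mkℚᵘ; _≃_)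
open import Data.List as L using (List; []; _∷_; _++_; [_]; length; filter; map; concatMap; upTo; lookup; drop; take)
open import Data.Vec as V using (Vec)
open import Data.Product using (_×_; _,_; proj₁; proj₂; ∃)
open import Relation.Nullary using (¬_)
open import Relation.Binary.PropositionalEquality using (_≡_)

-- Set partitions of {0,…,N-1}, encoded as restricted growth strings:
-- a list of block labels (a₀,…,a_{N-1}) with a₀ = 0 and
-- a_{i} ≤ 1 + max(a₀..a_{i-1}); paired with its number of blocks.
-- This is the standard bijective encoding of set partitions (element i lies
-- in block a_i, blocks numbered by order of their least element).

allPartitions : ℕ → List (List ℕ × ℕ)
allPartitions zero = [ ([] , 0) ]
allPartitions (suc n) =
  concatMap (λ lb → map (λ a → (proj₁ lb ++ [ a ] , (if a ≡ᵇ proj₂ lb then suc (proj₂ lb) else proj₂ lb)))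
                        (upTo (suc (proj₂ lb))))
            (allPartitions n)

elemᵇ : ℕ → List ℕ → Bool
elemᵇ a [] = false
elemᵇ a (b ∷ bs) = if a ≡ᵇ b then true else elemᵇ a bs

distinctᵇ : List ℕ → Bool
distinctᵇ [] = true
distinctᵇ (a ∷ as) = not (elemᵇ a as) ∧ distinctᵇ as

-- The distinguished sets: R₁ = {0,…,r₁-1}, R₂ = the next r₂ elements, etc.
-- (pairwise disjoint, |Rᵢ| = rᵢ).  Condition: within each Rᵢ, labels distinct.
separatesᵇ : List ℕ → List ℕ → Bool
separatesᵇ [] l = true
separatesᵇ (r ∷ rs) l = distinctᵇ (take r l) ∧ separatesᵇ rs (drop r l)

-- (r₁,…,r_q)-Stirling number of the second kind: number of partitions of an
-- N-element set into k nonempty blocks such that the elements of each Rᵢ lie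
-- in distinct blocks.
stirlingR : List ℕ → ℕ → ℕ → ℕ
stirlingR rs N k =
  length (L.filterᵇ (λ lb → (proj₂ lb ≡ᵇ k) ∧ separatesᵇ rs (proj₁ lb)) (allPartitions N))

rStirling : ℕ → ℕ → ℕ → ℕ
rStirling r n k = stirlingR [ r ] n k

Poly : Set
Poly = ℕ → ℚᵘ

ℤtoℚ : ℤ → ℚᵘ
ℤtoℚ z = mkℚᵘ z 0

ℕtoℚ : ℕ → ℚᵘ
ℕtoℚ n = ℤtoℚ (+ n)

-- finite sum Σ_{k=a}^{b} f k (empty if b < a)
sumFromTo : ℕ → ℕ → (ℕ → ℚᵘ) → ℚᵘ
sumFromTo a b f = L.foldr Q._+_ Q.0ℚᵘ (map (λ i → f (a ℕ.+ i)) (upTo (suc b ∸ a)))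

shiftX : ℕ → Poly → Poly
shiftX r P j = if j <ᵇ r then Q.0ℚᵘ else P (j ∸ r)

minusOne : Poly → Poly
minusOne P zero = P zero Q.- Q.1ℚᵘ
minusOne P (suc j) = P (suc j)

calF : ℕ → ℕ → ℕ → Poly
calF n r s k = if k ≤ᵇ n then ℕtoℚ (rStirling r (n ℕ.+ r) (k ℕ.+ r) ℕ.* (k ℕ.+ s) !) else Q.0ℚᵘ

Fr : ℕ → ∀ {q'} → Vec ℕ (suc q') → Poly
Fr n rs j =
  let rq   = V.last rs
      tot  = V.sum rs
      totm = tot ∸ rq
  in if j ≤ᵇ n ℕ.+ totm
     then ℕtoℚ (stirlingR (V.toList rs) (n ℕ.+ tot) (j ℕ.+ rq) ℕ.* (j ℕ.+ rq) !)
     else Q.0ℚᵘ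

powℤ : ℤ → ℕ → ℤ
powℤ a zero = + 1
powℤ a (suc k) = a ℤ.* powℤ a k

falling : ℤ → ℕ → ℤ
falling α zero = + 1
falling α (suc j) = falling α j ℤ.* (α ℤ.- + j)

-- 1/(-m)^k as a rational, for m ≥ 1 (junk value 0 when m = 0; the
-- theorem's hypothesis p ∤ m excludes m = 0).
invNegPow : ℕ → ℕ → ℚᵘ
invNegPow zero k = Q.0ℚᵘ
invNegPow (suc m') k = mkℚᵘ (powℤ (ℤ.- + 1) k) (suc m' ℕ.^ k ∸ 1)

-- p-adic congruence of rationals: a ≡ b (mod p ℤ_p) iff a - b ∈ pℤ_p ∩ ℚ,
-- i.e. a - b = p·c/d with c ∈ ℤ and p ∤ d.
_≡[mod_]_ : ℚᵘ → ℕ → ℚᵘ → Set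
a ≡[mod p ] b = ∃ λ (c : ℤ) → ∃ λ (d : ℕ) → (¬ (p ∣ suc d)) × ((a Q.- b) ≃ mkℚᵘ (+ p ℤ.* c) d)

_≡ₚ[mod_]_ : Poly → ℕ → Poly → Set
P ≡ₚ[mod p ] R = ∀ j → P j ≡[mod p ] R j

scalePoly : ℚᵘ → Poly → Poly
scalePoly c P j = c Q.* P j

prodFalling : ℤ → ∀ {q} → Vec ℕ q → ℤ
prodFalling α rs = V.foldr _ (λ r acc → falling α r ℤ.* acc) (+ 1) rs

sumOverNegPow : ℕ → ℕ → (ℕ → Poly) → Poly
sumOverNegPow p m P j = sumFromTo 1 (p ∸ 1) (λ k → invNegPow m k Q.* P k j)

open import Data.Fin as F using (Fin)
Nondecreasing : ∀ {q} → Vec ℕ q → Set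
Nondecreasing {q} rs = ∀ (i j : Fin q) → i F.≤ j → V.lookup rs i ℕ.≤ V.lookup rs j

module Submission where

-- Write a_N(K) = {N, K}_r · K! for the (r₁,…,r_q)-Stirling numbers and let Φ
-- be the binomial transform (Φ v)(i) = Σ_j C(i,j) v(j).  The partition
-- recurrence {N+1, K+1} = {N, K} + (K+1 − s_N)·{N, K+1}, with s_N the number
-- of earlier elements of the distinguished set containing element N+1, becomes
-- multiplication by (i − s_N) after Φ.  Hence Φ a_N (i) is a product of such
-- factors, equal to (i)_{r₁}⋯(i)_{r_q}·i^n for N = n + |r|; likewise the
-- coefficient vector of 𝓕_{p-1}(x; m, 0) transforms to (i + m)^{p-1}.
-- Because Φ is unitriangular, two integer vectors are congruent mod p as soon
-- as their transforms are.  After clearing the denominator M^{p-1} (M = m) the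
-- transforms to compare are
--   (i)_r·i^n · Σ_{k=1}^{p-1} (-1)^k M^{p-1-k} i^k   and   C·M^{p-1}·((i+M)^{p-1} − 1),
-- and Fermat's little theorem shows that they agree, separately for p ∤ i + m
-- (both vanish) and p ∣ i + m (i ≡ −M).

module IntegerSums where

  open import Data.Nat as ℕ using (ℕ; zero; suc)
  import Data.Nat.Properties as ℕP
  open import Data.Integer using (ℤ; +_; _+_; _*_)
  import Data.Integer.Properties as ℤP
  open import Data.Integer.Divisibility.Signed using (_∣_; divides; ∣m∣n⇒∣m+n)
  open import Data.Integer.Tactic.RingSolver using (solve-∀)
  open import Relation.Binary.PropositionalEquality

  Σ< : ℕ → (ℕ → ℤ) → ℤ
  Σ< zero f = + 0
  Σ< (suc n) f = Σ< n f + f n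

  Σ<-cong : ∀ n {f g : ℕ → ℤ} → (∀ j → j ℕ.< n → f j ≡ g j) → Σ< n f ≡ Σ< n g
  Σ<-cong zero h = refl
  Σ<-cong (suc n) h = cong₂ _+_ (Σ<-cong n (λ j j<n → h j (ℕP.m<n⇒m<1+n j<n))) (h n ℕP.≤-refl)

  Σ<-+ : ∀ n (f g : ℕ → ℤ) → Σ< n (λ j → f j + g j) ≡ Σ< n f + Σ< n g
  Σ<-+ zero f g = refl
  Σ<-+ (suc n) f g rewrite Σ<-+ n f g = interchange (Σ< n f) (Σ< n g) (f n) (g n)
    where
    interchange : ∀ a b c d → a + b + (c + d) ≡ a + c + (b + d)
    interchange = solve-∀

  Σ<-* : ∀ n c (f : ℕ → ℤ) → Σ< n (λ j → c * f j) ≡ c * Σ< n f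
  Σ<-* zero c f = sym (ℤP.*-zeroʳ c)
  Σ<-* (suc n) c f rewrite Σ<-* n c f = sym (ℤP.*-distribˡ-+ c (Σ< n f) (f n))

  Σ<-shift : ∀ n (f : ℕ → ℤ) → Σ< (suc n) f ≡ f 0 + Σ< n (λ j → f (suc j))
  Σ<-shift zero f = trans (ℤP.+-identityˡ (f 0)) (sym (ℤP.+-identityʳ (f 0)))
  Σ<-shift (suc n) f rewrite Σ<-shift n f = ℤP.+-assoc (f 0) _ _

  Σ<-zero : ∀ n (f : ℕ → ℤ) → (∀ j → j ℕ.< n → f j ≡ + 0) → Σ< n f ≡ + 0
  Σ<-zero n f h = trans (Σ<-cong n h) (Σ<-const0 n)
    where
    Σ<-const0 : ∀ n → Σ< n (λ _ → + 0) ≡ + 0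
    Σ<-const0 zero = refl
    Σ<-const0 (suc n) = cong (_+ + 0) (Σ<-const0 n)

  Σ<-∣ : ∀ d n (f : ℕ → ℤ) → (∀ j → j ℕ.< n → d ∣ f j) → d ∣ Σ< n f
  Σ<-∣ d zero f h = divides (+ 0) refl
  Σ<-∣ d (suc n) f h = ∣m∣n⇒∣m+n (Σ<-∣ d n f (λ j j<n → h j (ℕP.m<n⇒m<1+n j<n))) (h n ℕP.≤-refl)

module Binomials where

  open import Data.Nat as ℕ using (ℕ; zero; suc; s≤s)
  import Data.Nat.Properties as ℕP
  import Data.Nat.Divisibility as ND
  open import Data.Nat.Primality using (Prime; euclidsLemma)
  import Data.Nat.Tactic.RingSolver as ℕSolver
  open import Data.Integer using (ℤ; +_; _+_; _*_)
  import Data.Integer.Properties as ℤP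
  open import Data.Integer.Tactic.RingSolver using (solve-∀)
  open import Data.Sum using (inj₁; inj₂)
  open import Data.Empty using (⊥-elim)
  open import Relation.Binary.PropositionalEquality
  open import Defs using (powℤ)
  open IntegerSums

  -- binomial coefficients defined by Pascal's rule, so that their identities
  -- follow by induction along the rule
  choose : ℕ → ℕ → ℕ
  choose n zero = 1
  choose zero (suc k) = 0
  choose (suc n) (suc k) = choose n k ℕ.+ choose n (suc k)

  choose-vanish : ∀ n k → n ℕ.< k → choose n k ≡ 0
  choose-vanish zero (suc k) _ = refl
  choose-vanish (suc n) (suc k) (s≤s n<k)
    rewrite choose-vanish n k n<k | choose-vanish n (suc k) (ℕP.m<n⇒m<1+n n<k) = refl

  choose-diag : ∀ n → choose n n ≡ 1
  choose-diag zero = refl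
  choose-diag (suc n) rewrite choose-diag n | choose-vanish n (suc n) ℕP.≤-refl = refl

  choose-1 : ∀ n → choose n 1 ≡ n
  choose-1 zero = refl
  choose-1 (suc n) = cong suc (choose-1 n)

  -- i·C(i,j) = j·C(i,j) + (j+1)·C(i,j+1): the identity behind Φ-step below
  choose-weighted : ∀ i j → i ℕ.* choose i j ≡ j ℕ.* choose i j ℕ.+ suc j ℕ.* choose i (suc j)
  choose-weighted zero zero = refl
  choose-weighted zero (suc j) = sym (cong₂ ℕ._+_ (ℕP.*-zeroʳ (suc j)) (ℕP.*-zeroʳ (suc (suc j))))
  choose-weighted (suc i) zero rewrite choose-1 i = base i
    where
    base : ∀ i → (1 ℕ.+ i) ℕ.* 1 ≡ 0 ℕ.* 1 ℕ.+ 1 ℕ.* (1 ℕ.+ i)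
    base = ℕSolver.solve-∀
  choose-weighted (suc i) (suc j) =
    pascal-step (choose i j) (choose i (suc j)) (choose i (suc (suc j)))
                (choose-weighted i j) (choose-weighted i (suc j))
    where
    open ≡-Reasoning
    expand : ∀ i a b → (1 ℕ.+ i) ℕ.* (a ℕ.+ b) ≡ a ℕ.+ b ℕ.+ (i ℕ.* a ℕ.+ i ℕ.* b)
    expand = ℕSolver.solve-∀
    collect : ∀ j a b c → a ℕ.+ b ℕ.+ ((j ℕ.* a ℕ.+ (1 ℕ.+ j) ℕ.* b) ℕ.+ ((1 ℕ.+ j) ℕ.* b ℕ.+ (2 ℕ.+ j) ℕ.* c))
                          ≡ (1 ℕ.+ j) ℕ.* (a ℕ.+ b) ℕ.+ (2 ℕ.+ j) ℕ.* (b ℕ.+ c)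
    collect = ℕSolver.solve-∀
    pascal-step : ∀ a b c → i ℕ.* a ≡ j ℕ.* a ℕ.+ (1 ℕ.+ j) ℕ.* b → i ℕ.* b ≡ (1 ℕ.+ j) ℕ.* b ℕ.+ (2 ℕ.+ j) ℕ.* c →
                  (1 ℕ.+ i) ℕ.* (a ℕ.+ b) ≡ (1 ℕ.+ j) ℕ.* (a ℕ.+ b) ℕ.+ (2 ℕ.+ j) ℕ.* (b ℕ.+ c)
    pascal-step a b c h₁ h₂ = begin
      (1 ℕ.+ i) ℕ.* (a ℕ.+ b)                       ≡⟨ expand i a b ⟩
      a ℕ.+ b ℕ.+ (i ℕ.* a ℕ.+ i ℕ.* b)             ≡⟨ cong₂ (λ x y → a ℕ.+ b ℕ.+ (x ℕ.+ y)) h₁ h₂ ⟩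
      a ℕ.+ b ℕ.+ ((j ℕ.* a ℕ.+ (1 ℕ.+ j) ℕ.* b) ℕ.+ ((1 ℕ.+ j) ℕ.* b ℕ.+ (2 ℕ.+ j) ℕ.* c)) ≡⟨ collect j a b c ⟩
      (1 ℕ.+ j) ℕ.* (a ℕ.+ b) ℕ.+ (2 ℕ.+ j) ℕ.* (b ℕ.+ c) ∎

  choose-absorb : ∀ n k → suc k ℕ.* choose (suc n) (suc k) ≡ suc n ℕ.* choose n k
  choose-absorb zero zero = refl
  choose-absorb zero (suc k) = ℕP.*-zeroʳ (suc (suc k))
  choose-absorb (suc n) zero rewrite choose-1 n = base n
    where
    base : ∀ n → 1 ℕ.* (2 ℕ.+ n) ≡ (2 ℕ.+ n) ℕ.* 1
    base = ℕSolver.solve-∀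
  choose-absorb (suc n) (suc k) =
    pascal-step (choose n k) (choose n (suc k)) (choose (suc n) (suc (suc k)))
                (choose-absorb n k) (choose-absorb n (suc k))
    where
    open ≡-Reasoning
    expand : ∀ k b b′ c → (2 ℕ.+ k) ℕ.* ((b ℕ.+ b′) ℕ.+ c) ≡ (b ℕ.+ b′) ℕ.+ ((1 ℕ.+ k) ℕ.* (b ℕ.+ b′) ℕ.+ (2 ℕ.+ k) ℕ.* c)
    expand = ℕSolver.solve-∀
    collect : ∀ n b b′ → (b ℕ.+ b′) ℕ.+ ((1 ℕ.+ n) ℕ.* b ℕ.+ (1 ℕ.+ n) ℕ.* b′) ≡ (2 ℕ.+ n) ℕ.* (b ℕ.+ b′)
    collect = ℕSolver.solve-∀
    pascal-step : ∀ b b′ c → (1 ℕ.+ k) ℕ.* (b ℕ.+ b′) ≡ (1 ℕ.+ n) ℕ.* b → (2 ℕ.+ k) ℕ.* c ≡ (1 ℕ.+ n) ℕ.* b′ →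
                  (2 ℕ.+ k) ℕ.* ((b ℕ.+ b′) ℕ.+ c) ≡ (2 ℕ.+ n) ℕ.* (b ℕ.+ b′)
    pascal-step b b′ c h₁ h₂ = begin
      (2 ℕ.+ k) ℕ.* ((b ℕ.+ b′) ℕ.+ c)                                ≡⟨ expand k b b′ c ⟩
      (b ℕ.+ b′) ℕ.+ ((1 ℕ.+ k) ℕ.* (b ℕ.+ b′) ℕ.+ (2 ℕ.+ k) ℕ.* c)   ≡⟨ cong₂ (λ x y → (b ℕ.+ b′) ℕ.+ (x ℕ.+ y)) h₁ h₂ ⟩
      (b ℕ.+ b′) ℕ.+ ((1 ℕ.+ n) ℕ.* b ℕ.+ (1 ℕ.+ n) ℕ.* b′)           ≡⟨ collect n b b′ ⟩
      (2 ℕ.+ n) ℕ.* (b ℕ.+ b′)                                        ∎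

  -- p ∣ C(p, k) for 0 < k < p, since k·C(p,k) = p·C(p-1,k-1) and p ∤ k
  prime∣choose : ∀ {p} → Prime p → ∀ k → suc k ℕ.< p → p ND.∣ choose p (suc k)
  prime∣choose {suc p′} pr k k<p
    with euclidsLemma (suc k) (choose (suc p′) (suc k)) pr
           (ND.divides (choose p′ k) (trans (choose-absorb p′ k) (ℕP.*-comm (suc p′) _)))
  ... | inj₁ p∣k = ⊥-elim (ℕP.<⇒≱ k<p (ND.∣⇒≤ p∣k))
  ... | inj₂ p∣C = p∣C

  pos-suc : ∀ j → + suc j ≡ + j + + 1
  pos-suc j = trans (cong +_ (ℕP.+-comm 1 j)) (ℤP.pos-+ j 1)

  binomial-theorem : ∀ a n → powℤ (a + + 1) n ≡ Σ< (suc n) (λ k → + choose n k * powℤ a k)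
  binomial-theorem a zero = refl
  binomial-theorem a (suc n) = begin
    (a + + 1) * powℤ (a + + 1) n                  ≡⟨ cong ((a + + 1) *_) (binomial-theorem a n) ⟩
    (a + + 1) * B                                 ≡⟨ distrib a B ⟩
    a * B + B                                     ≡⟨ cong₂ _+_ (sym (Σ<-* (suc n) a _)) B-shifted ⟩
    Σ< (suc n) (λ k → a * T k) + (+ 1 + Σ< (suc n) (λ k → T (suc k)))
                                                  ≡⟨ rotate (Σ< (suc n) (λ k → a * T k)) _ ⟩
    + 1 + (Σ< (suc n) (λ k → a * T k) + Σ< (suc n) (λ k → T (suc k)))
                                                  ≡⟨ cong (λ y → + 1 + y) (sym (Σ<-+ (suc n) _ _)) ⟩
    + 1 + Σ< (suc n) (λ k → a * T k + T (suc k))  ≡⟨ cong (λ y → + 1 + y) (Σ<-cong (suc n) (λ k _ → pascal k)) ⟩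
    + 1 + Σ< (suc n) (λ k → V (suc k))            ≡⟨ sym (Σ<-shift (suc n) V) ⟩
    Σ< (suc (suc n)) V                            ∎
    where
    open ≡-Reasoning
    T V : ℕ → ℤ
    T k = + choose n k * powℤ a k
    V k = + choose (suc n) k * powℤ a k
    B : ℤ
    B = Σ< (suc n) T
    distrib : ∀ a B → (a + + 1) * B ≡ a * B + B
    distrib = solve-∀
    rotate : ∀ x y → x + (+ 1 + y) ≡ + 1 + (x + y)
    rotate = solve-∀
    B-shifted : B ≡ + 1 + Σ< (suc n) (λ k → T (suc k))
    B-shifted = begin
      B                                  ≡⟨ sym (ℤP.+-identityʳ B) ⟩
      B + + 0                            ≡⟨ cong (λ c → B + + c * powℤ a (suc n)) (sym (choose-vanish n (suc n) ℕP.≤-refl)) ⟩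
      Σ< (suc (suc n)) T                 ≡⟨ Σ<-shift (suc n) T ⟩
      + 1 * + 1 + Σ< (suc n) (λ k → T (suc k)) ∎
    pascal : ∀ k → a * T k + T (suc k) ≡ V (suc k)
    pascal k = trans (regroup a (+ choose n k) (+ choose n (suc k)) (powℤ a k))
                     (cong (_* powℤ a (suc k)) (sym (ℤP.pos-+ (choose n k) (choose n (suc k)))))
      where
      regroup : ∀ a x y w → a * (x * w) + y * (a * w) ≡ (x + y) * (a * w)
      regroup = solve-∀

module Congruences where

  open import Data.Nat as ℕ using (ℕ; zero; suc; s≤s)
  import Data.Nat.Divisibility as ND
  open import Data.Nat.Primality using (Prime; euclidsLemma)
  open import Data.Integer as ℤ using (ℤ; +_; -[1+_]; _+_; _*_; _-_; -_)
  import Data.Integer.Properties as ℤP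
  open import Data.Integer.Divisibility.Signed
  open import Data.Integer.Tactic.RingSolver using (solve-∀)
  open import Data.Sum using (inj₁; inj₂)
  open import Data.Empty using (⊥-elim)
  open import Relation.Nullary using (¬_)
  open import Relation.Binary.PropositionalEquality
  open import Data.Vec using (Vec; []; _∷_)
  open import Defs using (powℤ; falling; prodFalling)
  open IntegerSums
  open Binomials

  -- a ≡ b (mod p), packaged as a record so that it is never unfolded
  record Cong (p : ℕ) (a b : ℤ) : Set where
    constructor cong-mod
    field divides-difference : + p ∣ (a - b)
  open Cong public

  ∣-resp : ∀ {d x y} → x ≡ y → d ∣ x → d ∣ y
  ∣-resp {d} = subst (d ∣_)

  C-refl : ∀ {p} a → Cong p a a
  C-refl {p} a = cong-mod (∣-resp (sym (ℤP.+-inverseʳ a)) (divides (+ 0) refl))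

  C-≡ : ∀ {p a b} → a ≡ b → Cong p a b
  C-≡ {a = a} refl = C-refl a

  C-sym : ∀ {p a b} → Cong p a b → Cong p b a
  C-sym {p} {a} {b} (cong-mod h) = cong-mod (∣-resp (negate a b) (∣m⇒∣-m h))
    where
    negate : ∀ a b → - (a - b) ≡ b - a
    negate = solve-∀

  C-trans : ∀ {p a b c} → Cong p a b → Cong p b c → Cong p a c
  C-trans {p} {a} {b} {c} (cong-mod h₁) (cong-mod h₂) = cong-mod (∣-resp (telescope a b c) (∣m∣n⇒∣m+n h₁ h₂))
    where
    telescope : ∀ a b c → (a - b) + (b - c) ≡ a - c
    telescope = solve-∀

  C-+ : ∀ {p a b c d} → Cong p a b → Cong p c d → Cong p (a + c) (b + d)
  C-+ {p} {a} {b} {c} {d} (cong-mod h₁) (cong-mod h₂) = cong-mod (∣-resp (regroup a b c d) (∣m∣n⇒∣m+n h₁ h₂))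
    where
    regroup : ∀ a b c d → (a - b) + (c - d) ≡ (a + c) - (b + d)
    regroup = solve-∀

  C-neg : ∀ {p a b} → Cong p a b → Cong p (- a) (- b)
  C-neg {p} {a} {b} (cong-mod h) = cong-mod (∣-resp (negate a b) (∣m⇒∣-m h))
    where
    negate : ∀ a b → - (a - b) ≡ (- a) - (- b)
    negate = solve-∀

  C-* : ∀ {p a b c d} → Cong p a b → Cong p c d → Cong p (a * c) (b * d)
  C-* {p} {a} {b} {c} {d} (cong-mod h₁) (cong-mod h₂) =
    cong-mod (∣-resp (regroup a b c d) (∣m∣n⇒∣m+n (∣n⇒∣m*n a h₂) (∣m⇒∣m*n d h₁)))
    where
    regroup : ∀ a b c d → a * (c - d) + (a - b) * d ≡ a * c - b * d
    regroup = solve-∀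

  C-pow : ∀ {p a b} n → Cong p a b → Cong p (powℤ a n) (powℤ b n)
  C-pow zero h = C-refl (+ 1)
  C-pow (suc n) h = C-* h (C-pow n h)

  C-falling : ∀ {p x y} j → Cong p x y → Cong p (falling x j) (falling y j)
  C-falling zero h = C-refl (+ 1)
  C-falling (suc j) h = C-* (C-falling j h) (C-+ h (C-refl (- (+ j))))

  C-prodFalling : ∀ {p x y q} (rs : Vec ℕ q) → Cong p x y → Cong p (prodFalling x rs) (prodFalling y rs)
  C-prodFalling [] h = C-refl (+ 1)
  C-prodFalling (r ∷ rs) h = C-* (C-falling r h) (C-prodFalling rs h)

  C-0 : ∀ {p a} → + p ∣ a → Cong p a (+ 0)
  C-0 {p} {a} h = cong-mod (∣-resp (sym (ℤP.+-identityʳ a)) h)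

  -- (a+1)^p ≡ a^p + 1, by the binomial theorem and p ∣ C(p,k) for 0 < k < p
  freshman : ∀ {p} → Prime p → ∀ a → Cong p (powℤ (a + + 1) p) (powℤ a p + + 1)
  freshman {suc p′} pr a = C-trans (C-≡ expand) (C-trans (C-+ (C-+ (C-refl (+ 1)) middle) (C-≡ last-term)) (C-≡ (tidy (powℤ a p))))
    where
    open ≡-Reasoning
    p : ℕ
    p = suc p′
    f : ℕ → ℤ
    f k = + choose p k * powℤ a k
    D : ℤ
    D = Σ< p′ (λ k → f (suc k))
    expand : powℤ (a + + 1) p ≡ (+ 1 + D) + f p
    expand = begin
      powℤ (a + + 1) p     ≡⟨ binomial-theorem a p ⟩
      Σ< p f + f p         ≡⟨ cong (_+ f p) (Σ<-shift p′ f) ⟩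
      (+ 1 * + 1 + D) + f p ∎
    middle : Cong p D (+ 0)
    middle = C-0 (Σ<-∣ (+ p) p′ (λ k → f (suc k))
      (λ k k<p′ → ∣m⇒∣m*n {m = + choose p (suc k)} (powℤ a (suc k)) (∣ᵤ⇒∣ (prime∣choose pr k (s≤s k<p′)))))
    last-term : f p ≡ powℤ a p
    last-term = trans (cong (λ c → + c * powℤ a p) (choose-diag p)) (ℤP.*-identityˡ _)
    tidy : ∀ x → (+ 1 + + 0) + x ≡ x + + 1
    tidy = solve-∀

  -- Fermat for a ≥ 0, by induction on a with the freshman's dream
  fermat-ℕ : ∀ {p} → Prime p → ∀ a → Cong p (powℤ (+ a) p) (+ a)
  fermat-ℕ {suc p′} pr zero = C-refl (+ 0)
  fermat-ℕ {suc p′} pr (suc a) =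
    C-trans (C-≡ (cong (λ b → powℤ b (suc p′)) (pos-suc a)))
      (C-trans (freshman pr (+ a)) (C-trans (C-+ (fermat-ℕ pr a) (C-refl (+ 1))) (C-≡ (sym (pos-suc a)))))

  -- Fermat's little theorem: a^p ≡ a (mod p); a negative a is first moved to
  -- a non-negative representative of its residue class
  fermat : ∀ {p} → Prime p → ∀ a → Cong p (powℤ a p) a
  fermat pr (+ a) = fermat-ℕ pr a
  fermat {zero} () -[1+ k ]
  fermat {suc p′} pr -[1+ k ] = C-trans (C-pow (suc p′) lift) (C-trans (fermat-ℕ pr t) (C-sym lift))
    where
    open ≡-Reasoning
    t : ℕ
    t = p′ ℕ.* suc k
    -- -(k+1) ≡ p′(k+1) since their difference is -(k+1)·p
    lift : Cong (suc p′) -[1+ k ] (+ t)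
    lift = cong-mod (divides (- (+ suc k)) (begin
      - (+ suc k) - + (p′ ℕ.* suc k)  ≡⟨ cong (λ z → - (+ suc k) - z) (ℤP.pos-* p′ (suc k)) ⟩
      - (+ suc k) - + p′ * + suc k    ≡⟨ factor (+ suc k) (+ p′) ⟩
      - (+ suc k) * (+ p′ + + 1)      ≡⟨ cong (λ z → - (+ suc k) * z) (sym (pos-suc p′)) ⟩
      - (+ suc k) * + suc p′          ∎))
      where
      factor : ∀ s q → - s - q * s ≡ - s * (q + + 1)
      factor = solve-∀

  cancel : ∀ {p} → Prime p → ∀ c x → ¬ (+ p ∣ c) → + p ∣ c * x → + p ∣ x
  cancel {p} pr c x p∤c h with euclidsLemma ℤ.∣ c ∣ ℤ.∣ x ∣ pr (subst (p ND.∣_) (ℤP.abs-* c x) (∣⇒∣ᵤ h))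
  ... | inj₁ p∣c = ⊥-elim (p∤c (∣ᵤ⇒∣ p∣c))
  ... | inj₂ p∣x = ∣ᵤ⇒∣ p∣x

  fermat-unit : ∀ {p′} → Prime (suc p′) → ∀ a → ¬ (+ suc p′ ∣ a) → Cong (suc p′) (powℤ a p′) (+ 1)
  fermat-unit {p′} pr a p∤a =
    cong-mod (cancel pr a (powℤ a p′ - + 1) p∤a (∣-resp (factor a (powℤ a p′)) (divides-difference (fermat pr a))))
    where
    factor : ∀ a P → a * P - a ≡ a * (P - + 1)
    factor = solve-∀

module BinomialTransform where

  open import Data.Nat as ℕ using (ℕ; zero; suc)
  import Data.Nat.Properties as ℕP
  open import Data.Integer using (ℤ; +_; _+_; _*_)
  import Data.Integer.Properties as ℤP
  open import Data.Integer.Divisibility.Signed using (_∣_; ∣n⇒∣m*n; ∣m+n∣m⇒∣n)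
  open import Data.Integer.Tactic.RingSolver using (solve-∀)
  open import Data.Sum using (inj₁; inj₂)
  open import Relation.Binary.PropositionalEquality
  open IntegerSums
  open Binomials

  Φ : (ℕ → ℤ) → ℕ → ℤ
  Φ v i = Σ< (suc i) (λ j → + choose i j * v j)

  Φ-cong : ∀ {v w : ℕ → ℤ} → (∀ j → v j ≡ w j) → ∀ i → Φ v i ≡ Φ w i
  Φ-cong h i = Σ<-cong (suc i) (λ j _ → cong (+ choose i j *_) (h j))

  Φ-linear : ∀ α β (u v : ℕ → ℤ) i → Φ (λ j → α * u j + β * v j) i ≡ α * Φ u i + β * Φ v i
  Φ-linear α β u v i = begin
    Σ< (suc i) (λ j → + choose i j * (α * u j + β * v j))
      ≡⟨ Σ<-cong (suc i) (λ j _ → distribute (+ choose i j) α β (u j) (v j)) ⟩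
    Σ< (suc i) (λ j → α * (+ choose i j * u j) + β * (+ choose i j * v j))
      ≡⟨ Σ<-+ (suc i) _ _ ⟩
    Σ< (suc i) (λ j → α * (+ choose i j * u j)) + Σ< (suc i) (λ j → β * (+ choose i j * v j))
      ≡⟨ cong₂ _+_ (Σ<-* (suc i) α _) (Σ<-* (suc i) β _) ⟩
    α * Φ u i + β * Φ v i ∎
    where
    open ≡-Reasoning
    distribute : ∀ c α β x y → c * (α * x + β * y) ≡ α * (c * x) + β * (c * y)
    distribute = solve-∀

  Φ-unit : ∀ (v : ℕ → ℤ) → v 0 ≡ + 1 → (∀ j → v (suc j) ≡ + 0) → ∀ i → Φ v i ≡ + 1
  Φ-unit v v₀ vₛ i = begin
    Φ v i ≡⟨ Σ<-shift i (λ j → + choose i j * v j) ⟩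
    + 1 * v 0 + Σ< i (λ j → + choose i (suc j) * v (suc j))
      ≡⟨ cong₂ _+_ (trans (ℤP.*-identityˡ (v 0)) v₀)
                   (Σ<-zero i _ (λ j _ → trans (cong (+ choose i (suc j) *_) (vₛ j)) (ℤP.*-zeroʳ (+ choose i (suc j))))) ⟩
    + 1 ∎
    where open ≡-Reasoning

  -- the operator v ↦ (j·v(j-1) + (j + c)·v(j))_j, which models one step of
  -- the Stirling recurrence on the vectors K ↦ {N, K}·K!
  step : ℤ → (ℕ → ℤ) → ℕ → ℤ
  step c v zero = c * v zero
  step c v (suc j) = + suc j * v j + (+ suc j + c) * v (suc j)

  lowered : (ℕ → ℤ) → ℕ → ℤ
  lowered v zero = + 0
  lowered v (suc j) = + suc j * v j

  step-split : ∀ c v j → step c v j ≡ lowered v j + (+ j + c) * v j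
  step-split c v zero = sym (trans (ℤP.+-identityˡ _) (cong (_* v zero) (ℤP.+-identityˡ c)))
  step-split c v (suc j) = refl

  Φ-lowered : ∀ v i → Σ< (suc i) (λ j → + choose i j * lowered v j)
                    ≡ Σ< (suc i) (λ j → + choose i (suc j) * ((+ j + + 1) * v j))
  Φ-lowered v i = begin
    Σ< (suc i) (λ j → + choose i j * lowered v j)        ≡⟨ Σ<-shift i (λ j → + choose i j * lowered v j) ⟩
    + 1 * + 0 + S i                                       ≡⟨ ℤP.+-identityˡ _ ⟩
    S i                                                   ≡⟨ sym (ℤP.+-identityʳ _) ⟩
    S i + + 0                                             ≡⟨ cong (λ y → S i + y) (sym top-vanishes) ⟩
    S (suc i)                                             ≡⟨ Σ<-cong (suc i) (λ j _ → cong (λ y → + choose i (suc j) * (y * v j)) (pos-suc j)) ⟩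
    Σ< (suc i) (λ j → + choose i (suc j) * ((+ j + + 1) * v j)) ∎
    where
    open ≡-Reasoning
    S : ℕ → ℤ
    S n = Σ< n (λ j → + choose i (suc j) * (+ suc j * v j))
    top-vanishes : + choose i (suc i) * (+ suc i * v i) ≡ + 0
    top-vanishes = cong (λ c → + c * (+ suc i * v i)) (choose-vanish i (suc i) ℕP.≤-refl)

  choose-weighted-ℤ : ∀ i j → + i * + choose i j ≡ + j * + choose i j + (+ j + + 1) * + choose i (suc j)
  choose-weighted-ℤ i j = begin
    + i * + choose i j                                     ≡⟨ sym (ℤP.pos-* i _) ⟩
    + (i ℕ.* choose i j)                                   ≡⟨ cong +_ (choose-weighted i j) ⟩
    + (j ℕ.* choose i j ℕ.+ suc j ℕ.* choose i (suc j))    ≡⟨ ℤP.pos-+ (j ℕ.* choose i j) _ ⟩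
    + (j ℕ.* choose i j) + + (suc j ℕ.* choose i (suc j))
      ≡⟨ cong₂ _+_ (ℤP.pos-* j _) (trans (ℤP.pos-* (suc j) (choose i (suc j))) (cong (_* + choose i (suc j)) (pos-suc j))) ⟩
    + j * + choose i j + (+ j + + 1) * + choose i (suc j) ∎
    where open ≡-Reasoning

  Φ-step : ∀ c v i → Φ (step c v) i ≡ (+ i + c) * Φ v i
  Φ-step c v i = begin
    Σ< (suc i) (λ j → + choose i j * step c v j)
      ≡⟨ Σ<-cong (suc i) (λ j _ → trans (cong (+ choose i j *_) (step-split c v j)) (ℤP.*-distribˡ-+ (+ choose i j) (lowered v j) _)) ⟩
    Σ< (suc i) (λ j → + choose i j * lowered v j + + choose i j * ((+ j + c) * v j))
      ≡⟨ Σ<-+ (suc i) _ _ ⟩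
    Σ< (suc i) (λ j → + choose i j * lowered v j) + Σ< (suc i) (λ j → + choose i j * ((+ j + c) * v j))
      ≡⟨ cong (_+ Σ< (suc i) (λ j → + choose i j * ((+ j + c) * v j))) (Φ-lowered v i) ⟩
    Σ< (suc i) (λ j → + choose i (suc j) * ((+ j + + 1) * v j)) + Σ< (suc i) (λ j → + choose i j * ((+ j + c) * v j))
      ≡⟨ sym (Σ<-+ (suc i) _ _) ⟩
    Σ< (suc i) (λ j → + choose i (suc j) * ((+ j + + 1) * v j) + + choose i j * ((+ j + c) * v j))
      ≡⟨ Σ<-cong (suc i) (λ j _ → combine (+ i) (+ j) (+ choose i j) (+ choose i (suc j)) (v j) (choose-weighted-ℤ i j)) ⟩
    Σ< (suc i) (λ j → (+ i + c) * (+ choose i j * v j))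
      ≡⟨ Σ<-* (suc i) (+ i + c) _ ⟩
    (+ i + c) * Φ v i ∎
    where
    open ≡-Reasoning
    expand : ∀ J A B c x → B * ((J + + 1) * x) + A * ((J + c) * x) ≡ (J * A + (J + + 1) * B) * x + c * (A * x)
    expand = solve-∀
    collect : ∀ I A c x → I * A * x + c * (A * x) ≡ (I + c) * (A * x)
    collect = solve-∀
    combine : ∀ I J A B x → I * A ≡ J * A + (J + + 1) * B → B * ((J + + 1) * x) + A * ((J + c) * x) ≡ (I + c) * (A * x)
    combine I J A B x h = begin
      B * ((J + + 1) * x) + A * ((J + c) * x)     ≡⟨ expand J A B c x ⟩
      (J * A + (J + + 1) * B) * x + c * (A * x)   ≡⟨ cong (λ y → y * x + c * (A * x)) (sym h) ⟩
      I * A * x + c * (A * x)                     ≡⟨ collect I A c x ⟩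
      (I + c) * (A * x)                           ∎

  -- Φ is unitriangular (C(i,i) = 1), so divisibility of Φ v (i) for all i < B
  -- propagates to v (j) for all j < B
  Φ-triangular : ∀ (d : ℤ) (v : ℕ → ℤ) B → (∀ i → i ℕ.< B → d ∣ Φ v i) → ∀ j → j ℕ.< B → d ∣ v j
  Φ-triangular d v B h j j<B = below (suc j) j<B j ℕP.≤-refl
    where
    below : ∀ k → k ℕ.≤ B → ∀ l → l ℕ.< k → d ∣ v l
    below (suc k) k<B l l<k with ℕP.m≤n⇒m<n∨m≡n (ℕP.≤-pred l<k)
    ... | inj₁ l<k′ = below k (ℕP.≤-trans (ℕP.n≤1+n k) k<B) l l<k′
    ... | inj₂ refl = ∣m+n∣m⇒∣n Φl earlier
      where
      earlier : d ∣ Σ< l (λ j → + choose l j * v j)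
      earlier = Σ<-∣ d l _ (λ j j<l → ∣n⇒∣m*n (+ choose l j) (below l (ℕP.≤-trans (ℕP.n≤1+n l) k<B) j j<l))
      Φl : d ∣ Σ< l (λ j → + choose l j * v j) + v l
      Φl = subst (λ y → d ∣ Σ< l (λ j → + choose l j * v j) + y)
                 (trans (cong (λ z → + z * v l) (choose-diag l)) (ℤP.*-identityˡ (v l))) (h l k<B)

module BooleanFacts where

  open import Data.Bool using (Bool; true; false; _∧_; not; T)
  open import Data.Nat as ℕ using (ℕ; zero; suc; _*_; _∸_; _≤_; _<_; _≡ᵇ_; _<ᵇ_; _≤ᵇ_)
  import Data.Nat.Properties as ℕP
  open import Data.Empty using (⊥-elim)
  open import Data.Unit using (tt)
  open import Relation.Nullary using (¬_)
  open import Relation.Binary.PropositionalEquality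

  𝟙 : Bool → ℕ
  𝟙 true = 1
  𝟙 false = 0

  ≡ᵇ-true : ∀ a x → (a ≡ᵇ x) ≡ true → a ≡ x
  ≡ᵇ-true a x e = ℕP.≡ᵇ⇒≡ a x (subst T (sym e) tt)

  ≡ᵇ-refl : ∀ x → (x ≡ᵇ x) ≡ true
  ≡ᵇ-refl zero = refl
  ≡ᵇ-refl (suc x) = ≡ᵇ-refl x

  ≡ᵇ-neq : ∀ a x → ¬ (a ≡ x) → (a ≡ᵇ x) ≡ false
  ≡ᵇ-neq a x ne with a ≡ᵇ x in e
  ... | true = ⊥-elim (ne (≡ᵇ-true a x e))
  ... | false = refl

  ≡ᵇ-sym : ∀ a x → (a ≡ᵇ x) ≡ (x ≡ᵇ a)
  ≡ᵇ-sym zero zero = refl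
  ≡ᵇ-sym zero (suc x) = refl
  ≡ᵇ-sym (suc a) zero = refl
  ≡ᵇ-sym (suc a) (suc x) = ≡ᵇ-sym a x

  <ᵇ-true : ∀ a b → (a <ᵇ b) ≡ true → a < b
  <ᵇ-true a b e = ℕP.<ᵇ⇒< a b (subst T (sym e) tt)

  <ᵇ-false : ∀ a b → (a <ᵇ b) ≡ false → b ≤ a
  <ᵇ-false a b e = ℕP.≮⇒≥ (λ a<b → subst T e (ℕP.<⇒<ᵇ a<b))

  ≥⇒<ᵇ-false : ∀ a b → b ≤ a → (a <ᵇ b) ≡ false
  ≥⇒<ᵇ-false a b h with a <ᵇ b in e
  ... | true = ⊥-elim (ℕP.<⇒≱ (<ᵇ-true a b e) h)
  ... | false = refl

  <⇒<ᵇ-true : ∀ a b → a < b → (a <ᵇ b) ≡ true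
  <⇒<ᵇ-true a b h with a <ᵇ b in e
  ... | true = refl
  ... | false = ⊥-elim (ℕP.<⇒≱ h (<ᵇ-false a b e))

  ≤ᵇ-false : ∀ a b → (a ≤ᵇ b) ≡ false → b < a
  ≤ᵇ-false a b e = ℕP.≰⇒> (λ a≤b → subst T e (ℕP.≤⇒≤ᵇ a≤b))

  ∧-elimˡ : ∀ x y → (x ∧ y) ≡ true → x ≡ true
  ∧-elimˡ true y e = refl

  ∧-elimʳ : ∀ x y → (x ∧ y) ≡ true → y ≡ true
  ∧-elimʳ true y e = e

  𝟙-∧∧ : ∀ x y z → 𝟙 (x ∧ (y ∧ z)) ≡ 𝟙 (x ∧ y) * 𝟙 z
  𝟙-∧∧ true true true = refl
  𝟙-∧∧ true true false = refl
  𝟙-∧∧ true false z = refl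
  𝟙-∧∧ false y z = refl

  𝟙-not : ∀ e → 𝟙 (not e) ℕ.+ 𝟙 e ≡ 1
  𝟙-not true = refl
  𝟙-not false = refl

  𝟙-swap : ∀ b K x s → 𝟙 ((b ≡ᵇ K) ∧ x) * (b ∸ s) ≡ (K ∸ s) * 𝟙 ((b ≡ᵇ K) ∧ x)
  𝟙-swap b K x s with b ≡ᵇ K in e
  ... | true rewrite ≡ᵇ-true b K e = ℕP.*-comm (𝟙 x) (K ∸ s)
  ... | false = sym (ℕP.*-zeroʳ (K ∸ s))

module ListSums where

  open import Data.Bool using (Bool; true; false)
  open import Data.Nat using (ℕ; zero; suc; _+_; _*_; _<_)
  import Data.Nat.Properties as ℕP
  import Data.Nat.Tactic.RingSolver as ℕSolver
  open import Data.List as L using (List; []; _∷_; _++_; [_]; length; map; upTo; concat; concatMap)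
  open import Data.List.Relation.Unary.All using (All; []; _∷_)
  import Data.List.Properties as LP
  open import Relation.Binary.PropositionalEquality hiding ([_])
  open BooleanFacts using (𝟙)

  sumL : ∀ {A : Set} → (A → ℕ) → List A → ℕ
  sumL g [] = 0
  sumL g (x ∷ xs) = g x + sumL g xs

  module _ {A : Set} where

    sumL-filter : ∀ (f : A → Bool) xs → length (L.filterᵇ f xs) ≡ sumL (λ x → 𝟙 (f x)) xs
    sumL-filter f [] = refl
    sumL-filter f (x ∷ xs) with f x
    ... | true = cong suc (sumL-filter f xs)
    ... | false = sumL-filter f xs

    sumL-++ : ∀ (g : A → ℕ) xs ys → sumL g (xs ++ ys) ≡ sumL g xs + sumL g ys
    sumL-++ g [] ys = refl
    sumL-++ g (x ∷ xs) ys rewrite sumL-++ g xs ys = sym (ℕP.+-assoc (g x) _ _)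

    sumL-concat : ∀ (g : A → ℕ) xss → sumL g (concat xss) ≡ sumL (sumL g) xss
    sumL-concat g [] = refl
    sumL-concat g (xs ∷ xss) = trans (sumL-++ g xs (concat xss)) (cong (sumL g xs +_) (sumL-concat g xss))

    sumL-All : ∀ {g g′ : A → ℕ} {xs} → All (λ x → g x ≡ g′ x) xs → sumL g xs ≡ sumL g′ xs
    sumL-All [] = refl
    sumL-All (e ∷ es) = cong₂ _+_ e (sumL-All es)

    sumL-+ : ∀ (g h : A → ℕ) xs → sumL (λ x → g x + h x) xs ≡ sumL g xs + sumL h xs
    sumL-+ g h [] = refl
    sumL-+ g h (x ∷ xs) rewrite sumL-+ g h xs = interchange (g x) (h x) (sumL g xs) (sumL h xs)
      where
      interchange : ∀ a b c d → a + b + (c + d) ≡ a + c + (b + d)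
      interchange = ℕSolver.solve-∀

    sumL-* : ∀ c (g : A → ℕ) xs → sumL (λ x → c * g x) xs ≡ c * sumL g xs
    sumL-* c g [] = sym (ℕP.*-zeroʳ c)
    sumL-* c g (x ∷ xs) rewrite sumL-* c g xs = sym (ℕP.*-distribˡ-+ c (g x) _)

    sumL-cong : ∀ {g g′ : A → ℕ} xs → (∀ x → g x ≡ g′ x) → sumL g xs ≡ sumL g′ xs
    sumL-cong [] h = refl
    sumL-cong (x ∷ xs) h = cong₂ _+_ (h x) (sumL-cong xs h)

    sumL-0 : ∀ (xs : List A) → sumL (λ _ → 0) xs ≡ 0
    sumL-0 [] = refl
    sumL-0 (x ∷ xs) = sumL-0 xs

  sumL-map : ∀ {A B : Set} (g : B → ℕ) (h : A → B) xs → sumL g (map h xs) ≡ sumL (λ x → g (h x)) xs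
  sumL-map g h [] = refl
  sumL-map g h (x ∷ xs) = cong (g (h x) +_) (sumL-map g h xs)

  sumL-concatMap : ∀ {A B : Set} (g : B → ℕ) (h : A → List B) xs → sumL g (concatMap h xs) ≡ sumL (λ x → sumL g (h x)) xs
  sumL-concatMap g h xs = trans (sumL-concat g (map h xs)) (sumL-map (sumL g) h xs)

  sumTo : ℕ → (ℕ → ℕ) → ℕ
  sumTo b g = sumL g (upTo b)

  sumTo-suc : ∀ b g → sumTo (suc b) g ≡ sumTo b g + g b
  sumTo-suc b g = begin
    sumL g (upTo (suc b)) ≡⟨ cong (sumL g) (sym (LP.upTo-∷ʳ b)) ⟩
    sumL g (upTo b ++ [ b ]) ≡⟨ sumL-++ g (upTo b) [ b ] ⟩
    sumTo b g + (g b + 0) ≡⟨ cong (sumTo b g +_) (ℕP.+-identityʳ (g b)) ⟩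
    sumTo b g + g b ∎
    where open ≡-Reasoning

  sumTo-cong : ∀ b {g g′} → (∀ a → a < b → g a ≡ g′ a) → sumTo b g ≡ sumTo b g′
  sumTo-cong zero h = refl
  sumTo-cong (suc b) {g} {g′} h = trans (sumTo-suc b g) (trans (cong₂ _+_ (sumTo-cong b (λ a a<b → h a (ℕP.m<n⇒m<1+n a<b))) (h b ℕP.≤-refl)) (sym (sumTo-suc b g′)))

  sumTo-1 : ∀ b → sumTo b (λ _ → 1) ≡ b
  sumTo-1 zero = refl
  sumTo-1 (suc b) = trans (sumTo-suc b (λ _ → 1)) (trans (cong (_+ 1) (sumTo-1 b)) (ℕP.+-comm b 1))


module PartitionCounting where

  open import Defs
  open import Data.Bool using (Bool; true; false; _∧_; _∨_; not; if_then_else_; T)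
  import Data.Bool.Properties as BP
  open import Data.Nat as ℕ using (ℕ; zero; suc; _+_; _*_; _∸_; _≤_; _<_; z≤n; s≤s; _≡ᵇ_; _<ᵇ_)
  import Data.Nat.Properties as ℕP
  open import Data.List as L using (List; []; _∷_; _++_; [_]; length; map; take; drop; upTo; concatMap)
  open import Data.List.Relation.Unary.All as All using (All; []; _∷_)
  import Data.List.Relation.Unary.All.Properties as AllP
  import Data.List.Properties as LP
  open import Data.Product using (_×_; _,_; proj₁; proj₂)
  open import Data.Sum using (inj₁; inj₂)
  open import Data.Empty using (⊥-elim)
  open import Data.Unit using (tt)
  open import Relation.Binary.PropositionalEquality hiding ([_])
  open BooleanFacts
  open ListSums

  length-snoc : ∀ {A : Set} (l : List A) a → length (l ++ [ a ]) ≡ suc (length l)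
  length-snoc l a = trans (LP.length-++ l) (ℕP.+-comm (length l) 1)

  -- For a labelling l of the first N = length l elements, openSet rs l is the
  -- list of labels already used inside the distinguished set Rᵢ that contains
  -- element N (empty if N lies beyond all distinguished sets); openSetSize rs N
  -- is its length.  A new element N may not reuse these labels.
  openSet : List ℕ → List ℕ → List ℕ
  openSet [] l = []
  openSet (r ∷ rs) l = if length l <ᵇ r then l else openSet rs (drop r l)

  openSetSize : List ℕ → ℕ → ℕ
  openSetSize [] N = 0
  openSetSize (r ∷ rs) N = if N <ᵇ r then N else openSetSize rs (N ∸ r)

  take-++ : ∀ {A : Set} r (l ys : List A) → r ≤ length l → take r (l ++ ys) ≡ take r l
  take-++ zero l ys _ = refl
  take-++ (suc r) (x ∷ l) ys (s≤s h) = cong (x ∷_) (take-++ r l ys h)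

  drop-++ : ∀ {A : Set} r (l ys : List A) → r ≤ length l → drop r (l ++ ys) ≡ drop r l ++ ys
  drop-++ zero l ys _ = refl
  drop-++ (suc r) (x ∷ l) ys (s≤s h) = drop-++ r l ys h

  separates-[] : ∀ rs → separatesᵇ rs [] ≡ true
  separates-[] [] = refl
  separates-[] (r ∷ rs) rewrite LP.take-[] {A = ℕ} r | LP.drop-[] {A = ℕ} r = separates-[] rs

  elem-snoc : ∀ x l a → elemᵇ x (l ++ [ a ]) ≡ (elemᵇ x l ∨ (x ≡ᵇ a))
  elem-snoc x [] a with x ≡ᵇ a
  ... | true = refl
  ... | false = refl
  elem-snoc x (y ∷ l) a with x ≡ᵇ y
  ... | true = refl
  ... | false = elem-snoc x l a

  distinct-snoc : ∀ l a → distinctᵇ (l ++ [ a ]) ≡ (distinctᵇ l ∧ not (elemᵇ a l))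
  distinct-snoc [] a = refl
  distinct-snoc (x ∷ l) a rewrite elem-snoc x l a | distinct-snoc l a | ≡ᵇ-sym a x =
    rearrange (elemᵇ x l) (x ≡ᵇ a) (distinctᵇ l) (elemᵇ a l)
    where
    rearrange : ∀ e₁ q d e₂ → (not (e₁ ∨ q) ∧ (d ∧ not e₂)) ≡ ((not e₁ ∧ d) ∧ not (if q then true else e₂))
    rearrange true q d e₂ = refl
    rearrange false true d e₂ = sym (BP.∧-zeroʳ (true ∧ d))
    rearrange false false true e₂ = refl
    rearrange false false false e₂ = refl

  separates-snoc : ∀ rs l a → separatesᵇ rs (l ++ [ a ]) ≡ (separatesᵇ rs l ∧ not (elemᵇ a (openSet rs l)))
  separates-snoc [] l a = refl
  separates-snoc (r ∷ rs) l a with length l <ᵇ r in e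
  ... | true = begin
      distinctᵇ (take r (l ++ [ a ])) ∧ separatesᵇ rs (drop r (l ++ [ a ]))
        ≡⟨ cong₂ (λ u v → distinctᵇ u ∧ separatesᵇ rs v) (LP.take-all r (l ++ [ a ]) lr) (LP.drop-all r (l ++ [ a ]) lr) ⟩
      distinctᵇ (l ++ [ a ]) ∧ separatesᵇ rs []
        ≡⟨ cong₂ _∧_ (distinct-snoc l a) (separates-[] rs) ⟩
      (distinctᵇ l ∧ not (elemᵇ a l)) ∧ true
        ≡⟨ ∧-comm-not (distinctᵇ l) (elemᵇ a l) ⟩
      (distinctᵇ l ∧ true) ∧ not (elemᵇ a l)
        ≡⟨ cong (λ u → u ∧ not (elemᵇ a l)) (cong₂ (λ u v → distinctᵇ u ∧ v) (sym (LP.take-all r l lr′)) (sym (trans (cong (separatesᵇ rs) (LP.drop-all r l lr′)) (separates-[] rs)))) ⟩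
      (distinctᵇ (take r l) ∧ separatesᵇ rs (drop r l)) ∧ not (elemᵇ a l) ∎
    where
    open ≡-Reasoning
    lr : r ℕ.≥ length (l ++ [ a ])
    lr = subst (_≤ r) (sym (length-snoc l a)) (<ᵇ-true _ _ e)
    lr′ : r ℕ.≥ length l
    lr′ = ℕP.<⇒≤ (<ᵇ-true _ _ e)
    ∧-comm-not : ∀ d e → ((d ∧ not e) ∧ true) ≡ ((d ∧ true) ∧ not e)
    ∧-comm-not true true = refl
    ∧-comm-not true false = refl
    ∧-comm-not false e = refl
  ... | false = begin
      distinctᵇ (take r (l ++ [ a ])) ∧ separatesᵇ rs (drop r (l ++ [ a ]))
        ≡⟨ cong₂ (λ u v → distinctᵇ u ∧ separatesᵇ rs v) (take-++ r l [ a ] rl) (drop-++ r l [ a ] rl) ⟩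
      distinctᵇ (take r l) ∧ separatesᵇ rs (drop r l ++ [ a ])
        ≡⟨ cong (distinctᵇ (take r l) ∧_) (separates-snoc rs (drop r l) a) ⟩
      distinctᵇ (take r l) ∧ (separatesᵇ rs (drop r l) ∧ not (elemᵇ a (openSet rs (drop r l))))
        ≡⟨ sym (BP.∧-assoc (distinctᵇ (take r l)) _ _) ⟩
      (distinctᵇ (take r l) ∧ separatesᵇ rs (drop r l)) ∧ not (elemᵇ a (openSet rs (drop r l))) ∎
    where
    open ≡-Reasoning
    rl : r ≤ length l
    rl = <ᵇ-false _ _ e

  openSet-length : ∀ rs l → length (openSet rs l) ≡ openSetSize rs (length l)
  openSet-length [] l = refl
  openSet-length (r ∷ rs) l with length l <ᵇ r
  ... | true = refl
  ... | false = trans (openSet-length rs (drop r l)) (cong (openSetSize rs) (LP.length-drop r l))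

  openSet-All : ∀ {P : ℕ → Set} rs {l} → All P l → All P (openSet rs l)
  openSet-All [] h = []
  openSet-All (r ∷ rs) {l} h with length l <ᵇ r
  ... | true = h
  ... | false = openSet-All rs (AllP.drop⁺ r h)

  openSet-distinct : ∀ rs l → separatesᵇ rs l ≡ true → distinctᵇ (openSet rs l) ≡ true
  openSet-distinct [] l h = refl
  openSet-distinct (r ∷ rs) l h with length l <ᵇ r in e
  ... | true = trans (cong distinctᵇ (sym (LP.take-all r l (ℕP.<⇒≤ (<ᵇ-true _ _ e))))) (∧-elimˡ _ _ h)
  ... | false = openSet-distinct rs (drop r l) (∧-elimʳ _ _ h)

  elem-above : ∀ b S → All (_< b) S → elemᵇ b S ≡ false
  elem-above b [] h = refl
  elem-above b (x ∷ S) (x<b ∷ h) rewrite ≡ᵇ-neq b x (λ e → ℕP.<-irrefl (sym e) x<b) = elem-above b S h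

  count-eq0 : ∀ x b → b ≤ x → sumTo b (λ a → 𝟙 (a ≡ᵇ x)) ≡ 0
  count-eq0 x zero h = refl
  count-eq0 x (suc b) h = trans (sumTo-suc b _) (trans (cong₂ _+_ (count-eq0 x b (ℕP.<⇒≤ h)) (cong 𝟙 (≡ᵇ-neq b x (λ e → ℕP.<-irrefl e h)))) refl)

  count-eq : ∀ x b → x < b → sumTo b (λ a → 𝟙 (a ≡ᵇ x)) ≡ 1
  count-eq x (suc b) h with ℕP.m<1+n⇒m<n∨m≡n h
  ... | inj₁ x<b = trans (sumTo-suc b _) (trans (cong₂ _+_ (count-eq x b x<b) (cong 𝟙 (≡ᵇ-neq b x (λ e → ℕP.<-irrefl (sym e) x<b)))) refl)
  ... | inj₂ refl = trans (sumTo-suc b _) (cong₂ _+_ (count-eq0 x x ℕP.≤-refl) (cong 𝟙 (≡ᵇ-refl x)))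

  count-elem : ∀ b S → distinctᵇ S ≡ true → All (_< b) S → sumTo b (λ a → 𝟙 (elemᵇ a S)) ≡ length S
  count-elem b [] d h = sumL-0 (upTo b)
  count-elem b (x ∷ S) d (x<b ∷ h) = begin
    sumTo b (λ a → 𝟙 (elemᵇ a (x ∷ S))) ≡⟨ sumTo-cong b (λ a _ → pt a) ⟩
    sumTo b (λ a → 𝟙 (a ≡ᵇ x) + 𝟙 (elemᵇ a S)) ≡⟨ sumL-+ _ _ (upTo b) ⟩
    sumTo b (λ a → 𝟙 (a ≡ᵇ x)) + sumTo b (λ a → 𝟙 (elemᵇ a S)) ≡⟨ cong₂ _+_ (count-eq x b x<b) (count-elem b S (∧-elimʳ _ _ d) h) ⟩
    suc (length S) ∎
    where
    open ≡-Reasoning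
    nx : elemᵇ x S ≡ false
    nx with elemᵇ x S | ∧-elimˡ (not (elemᵇ x S)) _ d
    ... | false | _ = refl
    pt : ∀ a → 𝟙 (elemᵇ a (x ∷ S)) ≡ 𝟙 (a ≡ᵇ x) + 𝟙 (elemᵇ a S)
    pt a with a ≡ᵇ x in e
    ... | true rewrite ≡ᵇ-true a x e | nx = refl
    ... | false = refl

  count-split : ∀ b S → distinctᵇ S ≡ true → All (_< b) S → sumTo b (λ a → 𝟙 (not (elemᵇ a S))) + length S ≡ b
  count-split b S d h = begin
    sumTo b (λ a → 𝟙 (not (elemᵇ a S))) + length S ≡⟨ cong (sumTo b (λ a → 𝟙 (not (elemᵇ a S))) +_) (sym (count-elem b S d h)) ⟩
    sumTo b (λ a → 𝟙 (not (elemᵇ a S))) + sumTo b (λ a → 𝟙 (elemᵇ a S)) ≡⟨ sym (sumL-+ _ _ (upTo b)) ⟩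
    sumTo b (λ a → 𝟙 (not (elemᵇ a S)) + 𝟙 (elemᵇ a S)) ≡⟨ sumTo-cong b (λ a _ → 𝟙-not (elemᵇ a S)) ⟩
    sumTo b (λ _ → 1) ≡⟨ sumTo-1 b ⟩
    b ∎
    where open ≡-Reasoning

  count-notelem : ∀ b S → distinctᵇ S ≡ true → All (_< b) S → sumTo b (λ a → 𝟙 (not (elemᵇ a S))) ≡ b ∸ length S
  count-notelem b S d h = trans (sym (ℕP.m+n∸n≡m _ (length S))) (cong (_∸ length S) (count-split b S d h))

  distinct-length-≤ : ∀ b S → distinctᵇ S ≡ true → All (_< b) S → length S ≤ b
  distinct-length-≤ b S d h = subst (length S ≤_) (count-split b S d h) (ℕP.m≤n+m (length S) _)

  WellFormed : ℕ → List ℕ × ℕ → Set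
  WellFormed N lb = length (proj₁ lb) ≡ N × All (_< proj₂ lb) (proj₁ lb) × proj₂ lb ≤ N

  extend : List ℕ × ℕ → ℕ → List ℕ × ℕ
  extend lb a = (proj₁ lb ++ [ a ] , (if a ≡ᵇ proj₂ lb then suc (proj₂ lb) else proj₂ lb))

  extensions : List ℕ × ℕ → List (List ℕ × ℕ)
  extensions lb = map (extend lb) (upTo (suc (proj₂ lb)))

  extend-wellFormed : ∀ N l b → WellFormed N (l , b) → ∀ a → a < suc b → WellFormed (suc N) (extend (l , b) a)
  extend-wellFormed N l b (len , allb , b≤N) a a<sb with a ≡ᵇ b in e
  ... | true = trans (length-snoc l a) (cong suc len) , AllP.∷ʳ⁺ (All.map ℕP.m<n⇒m<1+n allb) a<sb , s≤s b≤N
  ... | false = trans (length-snoc l a) (cong suc len) , AllP.∷ʳ⁺ allb a<b , ℕP.m≤n⇒m≤1+n b≤N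
    where
    a<b : a < b
    a<b with ℕP.m<1+n⇒m<n∨m≡n a<sb
    ... | inj₁ h = h
    ... | inj₂ refl = ⊥-elim (subst T e (subst T (sym (≡ᵇ-refl a)) tt))

  allPartitions-wellFormed : ∀ N → All (WellFormed N) (allPartitions N)
  allPartitions-wellFormed zero = (refl , [] , z≤n) ∷ []
  allPartitions-wellFormed (suc N) = AllP.concat⁺ (AllP.map⁺ (All.map extensions-wellFormed (allPartitions-wellFormed N)))
    where
    extensions-wellFormed : ∀ {lb} → WellFormed N lb → All (WellFormed (suc N)) (extensions lb)
    extensions-wellFormed {l , b} wf =
      AllP.map⁺ (AllP.applyUpTo⁺₁ (λ a → a) (suc b) (λ {a} a<b → extend-wellFormed N l b wf a a<b))

  admissible : List ℕ → ℕ → List ℕ × ℕ → Bool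
  admissible rs K lb = (proj₂ lb ≡ᵇ K) ∧ separatesᵇ rs (proj₁ lb)

  stirlingR-as-sum : ∀ rs N K → stirlingR rs N K ≡ sumL (λ lb → 𝟙 (admissible rs K lb)) (allPartitions N)
  stirlingR-as-sum rs N K = sumL-filter (admissible rs K) (allPartitions N)

  stirlingR-vanishes : ∀ rs N K → (∀ lb → WellFormed N lb → 𝟙 (admissible rs K lb) ≡ 0) → stirlingR rs N K ≡ 0
  stirlingR-vanishes rs N K none = begin
    stirlingR rs N K                                           ≡⟨ stirlingR-as-sum rs N K ⟩
    sumL (λ lb → 𝟙 (admissible rs K lb)) (allPartitions N)     ≡⟨ sumL-All (All.map (λ {lb} → none lb) (allPartitions-wellFormed N)) ⟩
    sumL (λ _ → 0) (allPartitions N)                           ≡⟨ sumL-0 (allPartitions N) ⟩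
    0                                                          ∎
    where open ≡-Reasoning

  old-labels : ∀ rs N l b x → WellFormed N (l , b) →
    𝟙 (x ∧ separatesᵇ rs l) * sumTo b (λ a → 𝟙 (not (elemᵇ a (openSet rs l))))
      ≡ 𝟙 (x ∧ separatesᵇ rs l) * (b ∸ openSetSize rs N)
  old-labels rs N l b x (len , allb , _) with separatesᵇ rs l in es
  ... | false rewrite BP.∧-zeroʳ x = refl
  ... | true = cong (𝟙 (x ∧ true) *_) (begin
    sumTo b (λ a → 𝟙 (not (elemᵇ a (openSet rs l))))  ≡⟨ count-notelem b (openSet rs l) (openSet-distinct rs l es) (openSet-All rs allb) ⟩
    b ∸ length (openSet rs l)                          ≡⟨ cong (b ∸_) (trans (openSet-length rs l) (cong (openSetSize rs) len)) ⟩
    b ∸ openSetSize rs N                               ∎)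
    where open ≡-Reasoning

  extensions-admissible : ∀ rs K N l b → WellFormed N (l , b) →
    sumL (λ x → 𝟙 (admissible rs K x)) (extensions (l , b))
      ≡ 𝟙 ((b ≡ᵇ K) ∧ separatesᵇ rs l) * (b ∸ openSetSize rs N) + 𝟙 ((suc b ≡ᵇ K) ∧ separatesᵇ rs l)
  extensions-admissible rs K N l b wf@(len , allb , _) = begin
    sumL (λ x → 𝟙 (admissible rs K x)) (extensions (l , b))  ≡⟨ sumL-map _ (extend (l , b)) (upTo (suc b)) ⟩
    sumTo (suc b) count                                       ≡⟨ sumTo-suc b count ⟩
    sumTo b count + count b                                   ≡⟨ cong₂ _+_ old new ⟩
    𝟙 ((b ≡ᵇ K) ∧ separatesᵇ rs l) * (b ∸ openSetSize rs N) + 𝟙 ((suc b ≡ᵇ K) ∧ separatesᵇ rs l) ∎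
    where
    open ≡-Reasoning
    count : ℕ → ℕ
    count a = 𝟙 (admissible rs K (extend (l , b) a))
    old-label : ∀ a → a < b → count a ≡ 𝟙 ((b ≡ᵇ K) ∧ separatesᵇ rs l) * 𝟙 (not (elemᵇ a (openSet rs l)))
    old-label a a<b rewrite ≡ᵇ-neq a b (λ e → ℕP.<-irrefl e a<b) | separates-snoc rs l a = 𝟙-∧∧ (b ≡ᵇ K) _ _
    old : sumTo b count ≡ 𝟙 ((b ≡ᵇ K) ∧ separatesᵇ rs l) * (b ∸ openSetSize rs N)
    old = trans (sumTo-cong b old-label)
                (trans (sumL-* (𝟙 ((b ≡ᵇ K) ∧ separatesᵇ rs l)) (λ a → 𝟙 (not (elemᵇ a (openSet rs l)))) (upTo b)) (old-labels rs N l b (b ≡ᵇ K) wf))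
    new : count b ≡ 𝟙 ((suc b ≡ᵇ K) ∧ separatesᵇ rs l)
    new rewrite ≡ᵇ-refl b | separates-snoc rs l b | elem-above b (openSet rs l) (openSet-All rs allb)
              | BP.∧-identityʳ (separatesᵇ rs l) = refl

  -- classify the partitions of N+1 elements by their restriction to the first N
  stirlingR-suc : ∀ rs N K → stirlingR rs (suc N) K
    ≡ (K ∸ openSetSize rs N) * stirlingR rs N K + sumL (λ lb → 𝟙 ((suc (proj₂ lb) ≡ᵇ K) ∧ separatesᵇ rs (proj₁ lb))) (allPartitions N)
  stirlingR-suc rs N K = begin
    stirlingR rs (suc N) K
      ≡⟨ stirlingR-as-sum rs (suc N) K ⟩
    sumL (λ lb → 𝟙 (admissible rs K lb)) (concatMap extensions (allPartitions N))
      ≡⟨ sumL-concatMap _ extensions (allPartitions N) ⟩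
    sumL (λ lb → sumL (λ x → 𝟙 (admissible rs K x)) (extensions lb)) (allPartitions N)
      ≡⟨ sumL-All (All.map (λ {lb} wf → extensions-admissible rs K N (proj₁ lb) (proj₂ lb) wf) (allPartitions-wellFormed N)) ⟩
    sumL (λ lb → Old lb + New lb) (allPartitions N)
      ≡⟨ sumL-+ Old New (allPartitions N) ⟩
    sumL Old (allPartitions N) + R
      ≡⟨ cong (_+ R) (sumL-cong (allPartitions N) (λ lb → 𝟙-swap (proj₂ lb) K _ s)) ⟩
    sumL (λ lb → (K ∸ s) * 𝟙 (admissible rs K lb)) (allPartitions N) + R
      ≡⟨ cong (_+ R) (trans (sumL-* (K ∸ s) _ (allPartitions N)) (cong ((K ∸ s) *_) (sym (stirlingR-as-sum rs N K)))) ⟩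
    (K ∸ s) * stirlingR rs N K + R ∎
    where
    open ≡-Reasoning
    s : ℕ
    s = openSetSize rs N
    Old New : List ℕ × ℕ → ℕ
    Old lb = 𝟙 ((proj₂ lb ≡ᵇ K) ∧ separatesᵇ rs (proj₁ lb)) * (proj₂ lb ∸ s)
    New lb = 𝟙 ((suc (proj₂ lb) ≡ᵇ K) ∧ separatesᵇ rs (proj₁ lb))
    R : ℕ
    R = sumL New (allPartitions N)

  stirlingR-suc-zero : ∀ rs N → stirlingR rs (suc N) 0 ≡ 0
  stirlingR-suc-zero rs N =
    trans (stirlingR-suc rs N 0) (cong₂ _+_ (cong (_* stirlingR rs N 0) (ℕP.0∸n≡0 (openSetSize rs N))) (sumL-0 (allPartitions N)))

  stirlingR-recurrence : ∀ rs N K →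
    stirlingR rs (suc N) (suc K) ≡ stirlingR rs N K + (suc K ∸ openSetSize rs N) * stirlingR rs N (suc K)
  stirlingR-recurrence rs N K =
    trans (stirlingR-suc rs N (suc K))
          (trans (cong (same-blocks +_) (sym (stirlingR-as-sum rs N K))) (ℕP.+-comm same-blocks (stirlingR rs N K)))
    where
    same-blocks : ℕ
    same-blocks = (suc K ∸ openSetSize rs N) * stirlingR rs N (suc K)

  stirlingR-above : ∀ rs N K → N < K → stirlingR rs N K ≡ 0
  stirlingR-above rs N K N<K = stirlingR-vanishes rs N K none
    where
    none : ∀ lb → WellFormed N lb → 𝟙 (admissible rs K lb) ≡ 0
    none (l , b) (_ , _ , b≤N) rewrite ≡ᵇ-neq b K (λ e → ℕP.<-irrefl e (ℕP.≤-<-trans b≤N N<K)) = refl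

  -- the open labels are distinct, so there must be at least openSetSize blocks
  stirlingR-below : ∀ rs N K → K < openSetSize rs N → stirlingR rs N K ≡ 0
  stirlingR-below rs N K K<s = stirlingR-vanishes rs N K none
    where
    none : ∀ lb → WellFormed N lb → 𝟙 (admissible rs K lb) ≡ 0
    none (l , b) (len , allb , _) with b ≡ᵇ K in e | separatesᵇ rs l in es
    ... | false | _ = refl
    ... | true | false = refl
    ... | true | true = ⊥-elim (ℕP.<⇒≱ K<s open≤K)
      where
      open≤K : openSetSize rs N ≤ K
      open≤K = subst₂ _≤_ (trans (openSet-length rs l) (cong (openSetSize rs) len)) (≡ᵇ-true b K e)
                     (distinct-length-≤ b (openSet rs l) (openSet-distinct rs l es) (openSet-All rs allb))

  stirlingR-zero : ∀ rs K → stirlingR rs 0 K ≡ 𝟙 (0 ≡ᵇ K)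
  stirlingR-zero rs K =
    trans (stirlingR-as-sum rs 0 K)
          (trans (cong (λ z → 𝟙 ((0 ≡ᵇ K) ∧ z) + 0) (separates-[] rs)) (trans (ℕP.+-identityʳ _) (cong 𝟙 (BP.∧-identityʳ (0 ≡ᵇ K)))))

module StirlingTransforms where

  open import Defs
  open import Data.Bool using (true; false)
  open import Data.Nat as ℕ using (ℕ; zero; suc; _≤_; _<_; s≤s; _≡ᵇ_; _!)
  import Data.Nat.Properties as ℕP
  import Data.Nat.Tactic.RingSolver as ℕSolver
  open import Data.Integer using (ℤ; +_; _+_; _*_; _-_; -_)
  import Data.Integer.Properties as ℤP
  open import Data.Integer.Divisibility.Signed using (_∣_; divides)
  open import Data.Integer.Tactic.RingSolver using (solve-∀)
  open import Data.List using (List; _∷_; [_])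
  open import Data.Vec as V using (Vec; _∷_; [])
  open import Data.Sum using (_⊎_; inj₁; inj₂)
  open import Data.Empty using (⊥-elim)
  open import Relation.Binary.PropositionalEquality hiding ([_])
  open BinomialTransform
  open BooleanFacts
  open PartitionCounting

  stirlingVector : List ℕ → ℕ → ℕ → ℤ
  stirlingVector rs N K = + (stirlingR rs N K ℕ.* K !)

  openProduct : List ℕ → ℕ → ℤ → ℤ
  openProduct rs zero x = + 1
  openProduct rs (suc N) x = openProduct rs N x * (x - + openSetSize rs N)

  monus-* : ∀ a s c → s ≤ a ⊎ c ≡ 0 → + ((a ℕ.∸ s) ℕ.* c) ≡ (+ a - + s) * + c
  monus-* a s c (inj₁ s≤a) = trans (ℤP.pos-* (a ℕ.∸ s) c)
    (cong (_* + c) (trans (sym (ℤP.⊖-≥ s≤a)) (sym (ℤP.m-n≡m⊖n a s))))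
  monus-* a s c (inj₂ refl) = trans (cong +_ (ℕP.*-zeroʳ (a ℕ.∸ s))) (sym (ℤP.*-zeroʳ (+ a - + s)))

  -- (A + B·C)·(K·k) = K·(A·k) + B·(C·(K·k)), used with k = (K-1)! and K·k = K!
  regroup : ∀ A B C k K → (A ℕ.+ B ℕ.* C) ℕ.* (K ℕ.* k) ≡ K ℕ.* (A ℕ.* k) ℕ.+ B ℕ.* (C ℕ.* (K ℕ.* k))
  regroup = ℕSolver.solve-∀

  stirlingVector-step : ∀ rs N K → stirlingVector rs (suc N) K ≡ step (- (+ openSetSize rs N)) (stirlingVector rs N) K
  stirlingVector-step rs N zero =
    trans (cong (λ z → + (z ℕ.* 1)) (stirlingR-suc-zero rs N)) (sym no-empty-partition)
    where
    no-empty-partition : (- (+ openSetSize rs N)) * stirlingVector rs N 0 ≡ + 0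
    no-empty-partition with openSetSize rs N in es
    ... | zero = refl
    ... | suc s = trans (cong (λ z → - (+ suc s) * + (z ℕ.* 1)) (stirlingR-below rs N 0 (subst (0 <_) (sym es) (s≤s ℕ.z≤n))))
                        (ℤP.*-zeroʳ (- (+ suc s)))
  stirlingVector-step rs N (suc K) = begin
    + (stirlingR rs (suc N) (suc K) ℕ.* (suc K ℕ.* K !))
      ≡⟨ cong (λ z → + (z ℕ.* (suc K ℕ.* K !))) (stirlingR-recurrence rs N K) ⟩
    + ((A ℕ.+ (suc K ℕ.∸ s) ℕ.* B) ℕ.* (suc K ℕ.* K !))
      ≡⟨ cong +_ (regroup A (suc K ℕ.∸ s) B (K !) (suc K)) ⟩
    + (suc K ℕ.* (A ℕ.* K !) ℕ.+ (suc K ℕ.∸ s) ℕ.* (B ℕ.* (suc K ℕ.* K !)))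
      ≡⟨ ℤP.pos-+ (suc K ℕ.* (A ℕ.* K !)) _ ⟩
    + (suc K ℕ.* (A ℕ.* K !)) + + ((suc K ℕ.∸ s) ℕ.* (B ℕ.* (suc K ℕ.* K !)))
      ≡⟨ cong₂ _+_ (ℤP.pos-* (suc K) (A ℕ.* K !)) (monus-* (suc K) s _ no-truncation) ⟩
    + suc K * stirlingVector rs N K + (+ suc K - + s) * stirlingVector rs N (suc K) ∎
    where
    open ≡-Reasoning
    s = openSetSize rs N
    A : ℕ
    A = stirlingR rs N K
    B : ℕ
    B = stirlingR rs N (suc K)
    no-truncation : s ≤ suc K ⊎ B ℕ.* (suc K ℕ.* K !) ≡ 0
    no-truncation with ℕP.≤-<-connex s (suc K)
    ... | inj₁ s≤K = inj₁ s≤K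
    ... | inj₂ K<s = inj₂ (cong (ℕ._* (suc K ℕ.* K !)) (stirlingR-below rs N (suc K) K<s))

  -- generalisation of Σ_j C(i,j) {N,j} j! = i^N
  Φ-stirlingVector : ∀ rs N i → Φ (stirlingVector rs N) i ≡ openProduct rs N (+ i)
  Φ-stirlingVector rs zero i =
    Φ-unit (stirlingVector rs zero) (cong (λ z → + (z ℕ.* 1)) (stirlingR-zero rs 0))
           (λ j → cong (λ z → + (z ℕ.* (suc j !))) (stirlingR-zero rs (suc j))) i
  Φ-stirlingVector rs (suc N) i = begin
    Φ (stirlingVector rs (suc N)) i                  ≡⟨ Φ-cong (stirlingVector-step rs N) i ⟩
    Φ (step (- (+ s)) (stirlingVector rs N)) i      ≡⟨ Φ-step _ (stirlingVector rs N) i ⟩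
    (+ i - + s) * Φ (stirlingVector rs N) i          ≡⟨ cong ((+ i - + s) *_) (Φ-stirlingVector rs N i) ⟩
    (+ i - + s) * openProduct rs N (+ i)             ≡⟨ ℤP.*-comm (+ i - + s) _ ⟩
    openProduct rs (suc N) (+ i)                     ∎
    where
    open ≡-Reasoning
    s = openSetSize rs N

  openSetSize-beyond : ∀ {q} (rs : Vec ℕ q) t → V.sum rs ≤ t → openSetSize (V.toList rs) t ≡ 0
  openSetSize-beyond [] t h = refl
  openSetSize-beyond (r ∷ rs) t h rewrite ≥⇒<ᵇ-false t r (ℕP.m+n≤o⇒m≤o r h) =
    openSetSize-beyond rs (t ℕ.∸ r) (ℕP.m+n≤o⇒m≤o∸n (V.sum rs) (subst (_≤ t) (ℕP.+-comm r (V.sum rs)) h))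

  openProduct-pow : ∀ L N n x → (∀ t → N ≤ t → openSetSize L t ≡ 0) → openProduct L (n ℕ.+ N) x ≡ openProduct L N x * powℤ x n
  openProduct-pow L N zero x h = sym (ℤP.*-identityʳ _)
  openProduct-pow L N (suc n) x h rewrite h (n ℕ.+ N) (ℕP.m≤n+m N n) | openProduct-pow L N n x h =
    reassociate (openProduct L N x) (powℤ x n) x
    where
    reassociate : ∀ G P x → G * P * (x - + 0) ≡ G * (x * P)
    reassociate = solve-∀

  openProduct-falling : ∀ r L t x → t ≤ r → openProduct (r ∷ L) t x ≡ falling x t
  openProduct-falling r L zero x h = refl
  openProduct-falling r L (suc t) x h rewrite <⇒<ᵇ-true t r h | openProduct-falling r L t x (ℕP.<⇒≤ h) = refl

  openProduct-shift : ∀ r L n x → openProduct (r ∷ L) (n ℕ.+ r) x ≡ falling x r * openProduct L n x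
  openProduct-shift r L zero x = trans (openProduct-falling r L r x ℕP.≤-refl) (sym (ℤP.*-identityʳ _))
  openProduct-shift r L (suc n) x rewrite ≥⇒<ᵇ-false (n ℕ.+ r) r (ℕP.m≤n+m r n) | ℕP.m+n∸n≡m n r | openProduct-shift r L n x =
    ℤP.*-assoc (falling x r) (openProduct L n x) _

  openProduct-prodFalling : ∀ {q} (rs : Vec ℕ q) x → openProduct (V.toList rs) (V.sum rs) x ≡ prodFalling x rs
  openProduct-prodFalling [] x = refl
  openProduct-prodFalling (r ∷ rs) x
    rewrite ℕP.+-comm r (V.sum rs) | openProduct-shift r (V.toList rs) (V.sum rs) x | openProduct-prodFalling rs x = refl

  openProduct-total : ∀ {q} (rs : Vec ℕ q) n x → openProduct (V.toList rs) (n ℕ.+ V.sum rs) x ≡ prodFalling x rs * powℤ x n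
  openProduct-total rs n x =
    trans (openProduct-pow (V.toList rs) (V.sum rs) n x (openSetSize-beyond rs)) (cong (_* powℤ x n) (openProduct-prodFalling rs x))

  falling-vanish : ∀ i r → i < r → falling (+ i) r ≡ + 0
  falling-vanish i (suc r) h with ℕP.m<1+n⇒m<n∨m≡n h
  ... | inj₁ i<r rewrite falling-vanish i r i<r = refl
  ... | inj₂ refl rewrite ℤP.+-inverseʳ (+ i) = ℤP.*-zeroʳ (falling (+ i) i)

  prodFalling-vanish : ∀ {q′} (rs : Vec ℕ (suc q′)) i → i < V.last rs → prodFalling (+ i) rs ≡ + 0
  prodFalling-vanish (r ∷ []) i h rewrite falling-vanish i r h = refl
  prodFalling-vanish (r ∷ r′ ∷ rs) i h rewrite prodFalling-vanish (r′ ∷ rs) i h = ℤP.*-zeroʳ (falling (+ i) r)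

  -- fewer than r_q blocks are impossible: the transform vanishes below r_q,
  -- hence so does the vector, by triangularity (with modulus 0)
  stirlingR-below-last : ∀ {q′} (rs : Vec ℕ (suc q′)) n K → K < V.last rs → stirlingR (V.toList rs) (n ℕ.+ V.sum rs) K ≡ 0
  stirlingR-below-last rs n K K<r = factorial-cancel (ℤP.+-injective (trans (_∣_.equality vanishes) (ℤP.*-zeroʳ (_∣_.quotient vanishes))))
    where
    N : ℕ
    N = n ℕ.+ V.sum rs
    v : ℕ → ℤ
    v = stirlingVector (V.toList rs) N
    transform-vanishes : ∀ i → i < V.last rs → + 0 ∣ Φ v i
    transform-vanishes i i<r = divides (+ 0)
      (trans (Φ-stirlingVector (V.toList rs) N i)
        (trans (openProduct-total rs n (+ i)) (cong (_* powℤ (+ i) n) (prodFalling-vanish rs i i<r))))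
    vanishes : + 0 ∣ v K
    vanishes = Φ-triangular (+ 0) v (V.last rs) transform-vanishes K K<r
    factorial-cancel : stirlingR (V.toList rs) N K ℕ.* K ! ≡ 0 → stirlingR (V.toList rs) N K ≡ 0
    factorial-cancel e with ℕP.m*n≡0⇒m≡0∨n≡0 (stirlingR (V.toList rs) N K) e
    ... | inj₁ h = h
    ... | inj₂ h = ⊥-elim (ℕP.<⇒≢ (ℕP.1≤n! K) (sym h))

  -- the m-Stirling vector j ↦ {N+m, j+m}_m · j!, whose generating polynomial is 𝓕_N(x; m, 0)
  mStirlingVector : ℕ → ℕ → ℕ → ℤ
  mStirlingVector m N j = + (stirlingR [ m ] (N ℕ.+ m) (j ℕ.+ m) ℕ.* j !)

  openSetSize-after : ∀ m N → openSetSize [ m ] (N ℕ.+ m) ≡ 0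
  openSetSize-after m N rewrite ≥⇒<ᵇ-false (N ℕ.+ m) m (ℕP.m≤n+m m N) = refl

  stirlingR-below-single : ∀ m N K → K < m → stirlingR [ m ] (N ℕ.+ m) K ≡ 0
  stirlingR-below-single m N K h =
    subst (λ z → stirlingR [ m ] (N ℕ.+ z) K ≡ 0) (ℕP.+-identityʳ m) (stirlingR-below-last (m ∷ []) N K h)

  -- with at most m elements, all in the distinguished set, the only partition is into singletons
  stirlingR-inside : ∀ m s → s ≤ m → ∀ K → stirlingR [ m ] s K ≡ 𝟙 (K ≡ᵇ s)
  stirlingR-inside m zero h K = trans (stirlingR-zero [ m ] K) (cong 𝟙 (≡ᵇ-sym 0 K))
  stirlingR-inside m (suc s) h zero = stirlingR-suc-zero [ m ] s
  stirlingR-inside m (suc s) h (suc K)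
    rewrite stirlingR-recurrence [ m ] s K | <⇒<ᵇ-true s m h
          | stirlingR-inside m s (ℕP.<⇒≤ h) K | stirlingR-inside m s (ℕP.<⇒≤ h) (suc K) =
    trans (cong (𝟙 (K ≡ᵇ s) ℕ.+_) no-new-block) (ℕP.+-identityʳ _)
    where
    no-new-block : (suc K ℕ.∸ s) ℕ.* 𝟙 (suc K ≡ᵇ s) ≡ 0
    no-new-block with suc K ≡ᵇ s in e
    ... | true rewrite ≡ᵇ-true (suc K) s e | ℕP.n∸n≡0 s = refl
    ... | false = ℕP.*-zeroʳ (suc K ℕ.∸ s)

  mStirlingVector-step : ∀ m N j → mStirlingVector m (suc N) j ≡ step (+ m) (mStirlingVector m N) j
  mStirlingVector-step zero N zero = cong (λ z → + (z ℕ.* 1)) (stirlingR-suc-zero [ 0 ] (N ℕ.+ 0))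
  mStirlingVector-step (suc m′) N zero
    rewrite stirlingR-recurrence [ suc m′ ] (N ℕ.+ suc m′) m′ | openSetSize-after (suc m′) N
          | stirlingR-below-single (suc m′) N m′ ℕP.≤-refl
    = trans (cong +_ (lone-block (suc m′) (stirlingR [ suc m′ ] (N ℕ.+ suc m′) (suc m′))))
            (ℤP.pos-* (suc m′) (stirlingR [ suc m′ ] (N ℕ.+ suc m′) (suc m′) ℕ.* 1))
    where
    lone-block : ∀ a c → (0 ℕ.+ a ℕ.* c) ℕ.* 1 ≡ a ℕ.* (c ℕ.* 1)
    lone-block = ℕSolver.solve-∀
  mStirlingVector-step m N (suc j) rewrite stirlingR-recurrence [ m ] (N ℕ.+ m) (j ℕ.+ m) | openSetSize-after m N = begin
    + ((A ℕ.+ suc (j ℕ.+ m) ℕ.* B) ℕ.* (suc j ℕ.* j !))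
      ≡⟨ cong +_ (regroup A (suc (j ℕ.+ m)) B (j !) (suc j)) ⟩
    + (suc j ℕ.* (A ℕ.* j !) ℕ.+ suc (j ℕ.+ m) ℕ.* (B ℕ.* (suc j ℕ.* j !)))
      ≡⟨ ℤP.pos-+ (suc j ℕ.* (A ℕ.* j !)) _ ⟩
    + (suc j ℕ.* (A ℕ.* j !)) + + (suc (j ℕ.+ m) ℕ.* (B ℕ.* (suc j ℕ.* j !)))
      ≡⟨ cong₂ _+_ (ℤP.pos-* (suc j) (A ℕ.* j !)) (ℤP.pos-* (suc (j ℕ.+ m)) (B ℕ.* (suc j ℕ.* j !))) ⟩
    + suc j * mStirlingVector m N j + (+ suc j + + m) * mStirlingVector m N (suc j) ∎
    where
    open ≡-Reasoning
    A : ℕ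
    A = stirlingR [ m ] (N ℕ.+ m) (j ℕ.+ m)
    B : ℕ
    B = stirlingR [ m ] (N ℕ.+ m) (suc (j ℕ.+ m))

  Φ-mStirlingVector : ∀ m N i → Φ (mStirlingVector m N) i ≡ powℤ (+ i + + m) N
  Φ-mStirlingVector m zero i = Φ-unit (mStirlingVector m 0) singletons-only no-other i
    where
    singletons-only : mStirlingVector m 0 0 ≡ + 1
    singletons-only rewrite stirlingR-inside m m ℕP.≤-refl m | ≡ᵇ-refl m = refl
    no-other : ∀ j → mStirlingVector m 0 (suc j) ≡ + 0
    no-other j rewrite stirlingR-inside m m ℕP.≤-refl (suc j ℕ.+ m)
                     | ≡ᵇ-neq (suc j ℕ.+ m) m (λ e → ℕP.<-irrefl (sym e) (s≤s (ℕP.m≤n+m m j))) = refl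
  Φ-mStirlingVector m (suc N) i =
    trans (Φ-cong (mStirlingVector-step m N) i)
          (trans (Φ-step (+ m) (mStirlingVector m N) i) (cong ((+ i + + m) *_) (Φ-mStirlingVector m N i)))

-- Alternating Horner sums  horner M b w = Σ_{k=1}^{b} (-1)^k M^{b-k} w(k),
-- i.e. M^b · Σ_{k=1}^{b} w(k)/(-M)^k with the denominators cleared

module HornerSums where

  open import Data.Nat as ℕ using (ℕ; zero; suc)
  open import Data.Integer using (ℤ; +_; _+_; _*_; _-_; -_)
  import Data.Integer.Properties as ℤP
  open import Data.Integer.Tactic.RingSolver using (solve-∀)
  open import Relation.Binary.PropositionalEquality
  open import Defs using (powℤ)
  open IntegerSums
  open Binomials using (choose; pos-suc)
  open Congruences
  open BinomialTransform

  sign : ℕ → ℤ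
  sign k = powℤ (- (+ 1)) k

  horner : ℤ → ℕ → (ℕ → ℤ) → ℤ
  horner M zero w = + 0
  horner M (suc b) w = M * horner M b w + sign (suc b) * w (suc b)

  horner-cong : ∀ M b {w w′ : ℕ → ℤ} → (∀ k → w k ≡ w′ k) → horner M b w ≡ horner M b w′
  horner-cong M zero h = refl
  horner-cong M (suc b) h = cong₂ (λ x y → M * x + sign (suc b) * y) (horner-cong M b h) (h (suc b))

  horner-scale : ∀ M b c (w : ℕ → ℤ) → horner M b (λ k → c * w k) ≡ c * horner M b w
  horner-scale M zero c w = sym (ℤP.*-zeroʳ c)
  horner-scale M (suc b) c w rewrite horner-scale M b c w = factor M c (horner M b w) (sign (suc b)) (w (suc b))
    where
    factor : ∀ M c H s x → M * (c * H) + s * (c * x) ≡ c * (M * H + s * x)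
    factor = solve-∀

  horner-vanish : ∀ M b (w : ℕ → ℤ) → (∀ k → w k ≡ + 0) → horner M b w ≡ + 0
  horner-vanish M zero w h = refl
  horner-vanish M (suc b) w h rewrite horner-vanish M b w h | h (suc b) =
    cong₂ _+_ (ℤP.*-zeroʳ M) (ℤP.*-zeroʳ (sign (suc b)))

  C-horner : ∀ {p} M b {w w′ : ℕ → ℤ} → (∀ k → Cong p (w k) (w′ k)) → Cong p (horner M b w) (horner M b w′)
  C-horner M zero h = C-refl (+ 0)
  C-horner M (suc b) h = C-+ (C-* (C-refl M) (C-horner M b h)) (C-* (C-refl (sign (suc b))) (h (suc b)))

  Φ-horner : ∀ M b (w : ℕ → ℕ → ℤ) i → Φ (λ j → horner M b (λ k → w k j)) i ≡ horner M b (λ k → Φ (w k) i)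
  Φ-horner M zero w i = Σ<-zero (suc i) _ (λ j _ → ℤP.*-zeroʳ (+ choose i j))
  Φ-horner M (suc b) w i = trans (Φ-linear M (sign (suc b)) (λ j → horner M b (λ k → w k j)) (w (suc b)) i)
    (cong (λ z → M * z + sign (suc b) * Φ (w (suc b)) i) (Φ-horner M b w i))

  sign-pow : ∀ k t → sign k * powℤ t k ≡ powℤ (- t) k
  sign-pow zero t = refl
  sign-pow (suc k) t = trans (reassociate (sign k) (powℤ t k) t) (cong (- t *_) (sign-pow k t))
    where
    reassociate : ∀ s P t → (- (+ 1)) * s * (t * P) ≡ - t * (s * P)
    reassociate = solve-∀

  horner-geometric : ∀ M b t → (M + t) * (horner M b (powℤ t) + powℤ M b) ≡ M * powℤ M b - (- t) * powℤ (- t) b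
  horner-geometric M zero t = base M t
    where
    base : ∀ M t → (M + t) * (+ 0 + + 1) ≡ M * + 1 - (- t) * + 1
    base = solve-∀
  horner-geometric M (suc b) t = begin
    (M + t) * ((M * H + sign (suc b) * powℤ t (suc b)) + M * powℤ M b)
      ≡⟨ cong (λ z → (M + t) * ((M * H + z) + M * powℤ M b)) (sign-pow (suc b) t) ⟩
    (M + t) * ((M * H + (- t) * powℤ (- t) b) + M * powℤ M b)
      ≡⟨ expand M t H (powℤ M b) (powℤ (- t) b) ⟩
    M * ((M + t) * (H + powℤ M b)) + (M + t) * ((- t) * powℤ (- t) b)
      ≡⟨ cong (λ z → M * z + (M + t) * ((- t) * powℤ (- t) b)) (horner-geometric M b t) ⟩
    M * (M * powℤ M b - (- t) * powℤ (- t) b) + (M + t) * ((- t) * powℤ (- t) b)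
      ≡⟨ collect M t (powℤ M b) (powℤ (- t) b) ⟩
    M * (M * powℤ M b) - (- t) * ((- t) * powℤ (- t) b) ∎
    where
    open ≡-Reasoning
    H : ℤ
    H = horner M b (powℤ t)
    expand : ∀ M t H P Q → (M + t) * ((M * H + (- t) * Q) + M * P) ≡ M * ((M + t) * (H + P)) + (M + t) * ((- t) * Q)
    expand = solve-∀
    collect : ∀ M t P Q → M * (M * P - (- t) * Q) + (M + t) * ((- t) * Q) ≡ M * (M * P) - (- t) * ((- t) * Q)
    collect = solve-∀

  -- at t = −M every term equals M^b, so the sum is b·M^b
  horner-at-negM : ∀ M b → horner M b (powℤ (- M)) ≡ + b * powℤ M b
  horner-at-negM M zero = refl
  horner-at-negM M (suc b) rewrite horner-at-negM M b = begin
    M * (+ b * powℤ M b) + sign (suc b) * powℤ (- M) (suc b)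
      ≡⟨ cong (λ z → M * (+ b * powℤ M b) + z) (trans (sign-pow (suc b) (- M)) (cong (λ z → powℤ z (suc b)) (ℤP.neg-involutive M))) ⟩
    M * (+ b * powℤ M b) + M * powℤ M b   ≡⟨ collect M (+ b) (powℤ M b) ⟩
    (+ b + + 1) * (M * powℤ M b)          ≡⟨ cong (_* (M * powℤ M b)) (sym (pos-suc b)) ⟩
    + suc b * (M * powℤ M b)              ∎
    where
    open ≡-Reasoning
    collect : ∀ M B P → M * (B * P) + M * P ≡ (B + + 1) * (M * P)
    collect = solve-∀

  powℤ-+ : ∀ x n k → powℤ x (n ℕ.+ k) ≡ powℤ x n * powℤ x k
  powℤ-+ x zero k = sym (ℤP.*-identityˡ _)
  powℤ-+ x (suc n) k rewrite powℤ-+ x n k = sym (ℤP.*-assoc x _ _)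

module IntegerForm where

  open import Data.Nat as ℕ using (ℕ; zero; suc)
  import Data.Nat.Properties as ℕP
  import Data.Nat.Divisibility as ND
  open import Data.Nat.Primality using (Prime)
  open import Data.Integer using (ℤ; +_; _+_; _*_; _-_; -_)
  import Data.Integer.Properties as ℤP
  open import Data.Integer.Divisibility.Signed using (_∣_; ∣-refl; ∣ᵤ⇒∣; ∣⇒∣ᵤ)
  open import Data.List using (List)
  open import Data.Vec as V using (Vec)
  open import Relation.Nullary using (¬_)
  open import Data.Integer.Tactic.RingSolver using (solve-∀)
  open import Relation.Binary.PropositionalEquality
  open import Relation.Nullary using (yes; no)
  open import Defs using (powℤ; prodFalling)
  open BinomialTransform
  open Congruences
  open HornerSums
  open StirlingTransforms
  open Binomials using (pos-suc)

  -- for the prime p = b′ + 2, p ∤ m, and set sizes rs = (r₁,…,r_q)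
  module Parameters (n m b′ : ℕ) (pr : Prime (suc (suc b′))) (p∤m : ¬ (suc (suc b′) ND.∣ m))
           {q′ : ℕ} (rs : Vec ℕ (suc q′)) where

    p : ℕ
    p = suc (suc b′)
    b : ℕ
    b = suc b′     -- b = p − 1
    M : ℤ
    M = + m
    rs-list : List ℕ
    rs-list = V.toList rs
    total : ℕ
    total = V.sum rs
    C : ℤ
    C = powℤ (- M) n * prodFalling (- M) rs
    D : ℤ
    D = powℤ M b

    unit : ℕ → ℤ
    unit zero = + 1
    unit (suc j) = + 0

    -- M^{p-1} · Σ_{k=1}^{p-1} (coefficient of x^{j} in F_{n+k}) / (-M)^k
    lhsVector : ℕ → ℤ
    lhsVector j = horner M b (λ k → stirlingVector rs-list ((n ℕ.+ k) ℕ.+ total) j)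

    -- M^{p-1} · C · (coefficient of x^j in 𝓕_{p-1}(x; m, 0) − 1)
    rhsVector : ℕ → ℤ
    rhsVector j = C * (mStirlingVector m b j - unit j) * D

    Φ-lhsVector : ∀ i → Φ lhsVector i ≡ (prodFalling (+ i) rs * powℤ (+ i) n) * horner M b (powℤ (+ i))
    Φ-lhsVector i = begin
      Φ lhsVector i
        ≡⟨ Φ-horner M b (λ k → stirlingVector rs-list ((n ℕ.+ k) ℕ.+ total)) i ⟩
      horner M b (λ k → Φ (stirlingVector rs-list ((n ℕ.+ k) ℕ.+ total)) i)
        ≡⟨ horner-cong M b term ⟩
      horner M b (λ k → G * powℤ (+ i) k)
        ≡⟨ horner-scale M b G (powℤ (+ i)) ⟩
      G * horner M b (powℤ (+ i)) ∎
      where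
      open ≡-Reasoning
      G : ℤ
      G = prodFalling (+ i) rs * powℤ (+ i) n
      term : ∀ k → Φ (stirlingVector rs-list ((n ℕ.+ k) ℕ.+ total)) i ≡ G * powℤ (+ i) k
      term k = begin
        Φ (stirlingVector rs-list ((n ℕ.+ k) ℕ.+ total)) i  ≡⟨ Φ-stirlingVector rs-list ((n ℕ.+ k) ℕ.+ total) i ⟩
        openProduct rs-list ((n ℕ.+ k) ℕ.+ total) (+ i)     ≡⟨ openProduct-total rs (n ℕ.+ k) (+ i) ⟩
        prodFalling (+ i) rs * powℤ (+ i) (n ℕ.+ k)         ≡⟨ cong (prodFalling (+ i) rs *_) (powℤ-+ (+ i) n k) ⟩
        prodFalling (+ i) rs * (powℤ (+ i) n * powℤ (+ i) k) ≡⟨ sym (ℤP.*-assoc (prodFalling (+ i) rs) _ _) ⟩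
        G * powℤ (+ i) k                                    ∎

    Φ-rhsVector : ∀ i → Φ rhsVector i ≡ (C * D) * powℤ (+ i + M) b + (- (C * D)) * + 1
    Φ-rhsVector i = begin
      Φ rhsVector i
        ≡⟨ Φ-cong (λ j → spread C (mStirlingVector m b j) (unit j) D) i ⟩
      Φ (λ j → (C * D) * mStirlingVector m b j + (- (C * D)) * unit j) i
        ≡⟨ Φ-linear (C * D) (- (C * D)) (mStirlingVector m b) unit i ⟩
      (C * D) * Φ (mStirlingVector m b) i + (- (C * D)) * Φ unit i
        ≡⟨ cong₂ (λ u v → (C * D) * u + (- (C * D)) * v) (Φ-mStirlingVector m b i) (Φ-unit unit refl (λ _ → refl) i) ⟩
      (C * D) * powℤ (+ i + M) b + (- (C * D)) * + 1 ∎
      where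
      open ≡-Reasoning
      spread : ∀ C h d D → C * (h - d) * D ≡ (C * D) * h + (- (C * D)) * d
      spread = solve-∀

    p∤⇒p∤ᵤ : ∀ a → ¬ (p ND.∣ a) → ¬ (+ p ∣ + a)
    p∤⇒p∤ᵤ a p∤a h = p∤a (∣⇒∣ᵤ h)

    -- if p ∤ M and p ∤ M + t, the geometric sum Σ_{k=1}^{p-1} (-t)^k M^{p-1-k}
    -- vanishes mod p, since (M + t)(sum + M^{p-1}) = M^p − (−t)^p ≡ M + t
    horner-vanishes-mod-p : ∀ t → ¬ (+ p ∣ M + t) → Cong p (horner M b (powℤ t)) (+ 0)
    horner-vanishes-mod-p t p∤M+t = C-trans (C-≡ (split H D)) (C-trans (C-+ sum+D≡1 (C-neg D≡1)) (C-≡ refl))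
      where
      H : ℤ
      H = horner M b (powℤ t)
      split : ∀ H D → H ≡ (H + D) + - D
      split = solve-∀
      times : Cong p ((M + t) * (H + D)) (M + t)
      times = C-trans (C-≡ (horner-geometric M b t))
                (C-trans (C-+ (fermat pr M) (C-neg (fermat pr (- t)))) (C-≡ (cancel-neg M t)))
        where
        cancel-neg : ∀ M t → M - (- t) ≡ M + t
        cancel-neg = solve-∀
      sum+D≡1 : Cong p (H + D) (+ 1)
      sum+D≡1 = cong-mod (cancel pr (M + t) _ p∤M+t (∣-resp (factor (M + t) (H + D)) (divides-difference times)))
        where
        factor : ∀ a X → a * X - a ≡ a * (X - + 1)
        factor = solve-∀
      D≡1 : Cong p D (+ 1)
      D≡1 = fermat-unit pr M (p∤⇒p∤ᵤ m p∤m)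

    -- case p ∤ i + m: both transforms vanish mod p
    transforms-agree-coprime : ∀ i → ¬ (p ND.∣ (i ℕ.+ m)) → Cong p (Φ lhsVector i) (Φ rhsVector i)
    transforms-agree-coprime i p∤i+m =
      C-trans (C-≡ (Φ-lhsVector i)) (C-trans lhs≡0 (C-sym (C-trans (C-≡ (Φ-rhsVector i)) rhs≡0)))
      where
      t : ℤ
      t = + i
      G : ℤ
      G = prodFalling t rs * powℤ t n
      p∤M+t : ¬ (+ p ∣ (M + t))
      p∤M+t = p∤⇒p∤ᵤ (m ℕ.+ i) (subst (λ z → ¬ (p ND.∣ z)) (ℕP.+-comm i m) p∤i+m)
      lhs≡0 : Cong p (G * horner M b (powℤ t)) (+ 0)
      lhs≡0 = C-trans (C-* (C-refl G) (horner-vanishes-mod-p t p∤M+t)) (C-≡ (ℤP.*-zeroʳ G))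
      rhs≡0 : Cong p ((C * D) * powℤ (t + M) b + (- (C * D)) * + 1) (+ 0)
      rhs≡0 = C-trans (C-+ (C-* (C-refl (C * D)) (fermat-unit pr (t + M) (p∤⇒p∤ᵤ (i ℕ.+ m) p∤i+m))) (C-refl _))
                      (C-≡ (cancel-out (C * D)))
        where
        cancel-out : ∀ x → x * + 1 + (- x) * + 1 ≡ + 0
        cancel-out = solve-∀

    -- case p ∣ i + m: i ≡ −M, the Horner sum is (p−1)·M^{p−1} ≡ −D and (i + M)^{p−1} ≡ 0
    transforms-agree-divisible : ∀ i → p ND.∣ (i ℕ.+ m) → Cong p (Φ lhsVector i) (Φ rhsVector i)
    transforms-agree-divisible i p∣i+m =
      C-trans (C-≡ (Φ-lhsVector i)) (C-trans lhs (C-sym (C-trans (C-≡ (Φ-rhsVector i)) rhs)))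
      where
      t : ℤ
      t = + i
      G : ℤ
      G = prodFalling (- M) rs
      Q : ℤ
      Q = powℤ (- M) n
      t≡-M : Cong p t (- M)
      t≡-M = cong-mod (∣-resp (rewrite-sum t M) (∣ᵤ⇒∣ p∣i+m))
        where
        rewrite-sum : ∀ t M → t + M ≡ t - (- M)
        rewrite-sum = solve-∀
      b≡-1 : Cong p (+ b) (- (+ 1))
      b≡-1 = cong-mod (∣-resp (pos-suc b) ∣-refl)
      horner≡-D : Cong p (horner M b (powℤ t)) (- (+ 1) * D)
      horner≡-D = C-trans (C-horner M b (λ k → C-pow k t≡-M)) (C-trans (C-≡ (horner-at-negM M b)) (C-* b≡-1 (C-refl D)))
      lhs : Cong p ((prodFalling t rs * powℤ t n) * horner M b (powℤ t)) ((G * Q) * (- (+ 1) * D))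
      lhs = C-* (C-* (C-prodFalling rs t≡-M) (C-pow n t≡-M)) horner≡-D
      t+M≡0 : Cong p (t + M) (+ 0)
      t+M≡0 = C-trans (C-+ t≡-M (C-refl M)) (C-≡ (ℤP.+-inverseˡ M))
      rhs : Cong p ((C * D) * powℤ (t + M) b + (- (C * D)) * + 1) ((G * Q) * (- (+ 1) * D))
      rhs = C-trans (C-+ (C-* (C-refl (C * D)) (C-* t+M≡0 (C-refl (powℤ (t + M) b′)))) (C-refl _))
                    (C-≡ (collapse G Q D (powℤ (t + M) b′)))
        where
        collapse : ∀ G Q D Z → (Q * G) * D * (+ 0 * Z) + (- ((Q * G) * D)) * + 1 ≡ G * Q * (- (+ 1) * D)
        collapse = solve-∀

    transforms-agree : ∀ i → Cong p (Φ lhsVector i) (Φ rhsVector i)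
    transforms-agree i with ND._∣?_ p (i ℕ.+ m)
    ... | yes p∣i+m = transforms-agree-divisible i p∣i+m
    ... | no p∤i+m = transforms-agree-coprime i p∤i+m

    -- the congruence of coefficients, by triangularity of Φ applied to lhs − rhs
    vectors-agree : ∀ j → Cong p (lhsVector j) (rhsVector j)
    vectors-agree j = cong-mod (∣-resp (as-difference (lhsVector j) (rhsVector j))
      (Φ-triangular (+ p) difference (suc j) difference-transform j ℕP.≤-refl))
      where
      as-difference : ∀ X R → + 1 * X + (- (+ 1)) * R ≡ X - R
      as-difference = solve-∀
      difference : ℕ → ℤ
      difference j = + 1 * lhsVector j + (- (+ 1)) * rhsVector j
      difference-transform : ∀ i → i ℕ.< suc j → + p ∣ Φ difference i
      difference-transform i _ =
        ∣-resp (trans (sym (as-difference (Φ lhsVector i) (Φ rhsVector i))) (sym (Φ-linear (+ 1) (- (+ 1)) lhsVector rhsVector i)))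
               (divides-difference (transforms-agree i))

-- Translation to the rational statement: the j-th coefficient of the left
-- side is lhsVector j / M^{p-1}, that of the right side is rhsVector j / M^{p-1},
-- so their difference is (lhsVector j − rhsVector j)/M^{p-1} with p ∤ M^{p-1}.

module RationalForm where

  open import Defs
  open import Data.Bool using (true; false)
  open import Data.Nat as ℕ using (ℕ; zero; suc; _≤_; _<_; s≤s; _≤ᵇ_; _<ᵇ_; _!)
  import Data.Nat.Properties as ℕP
  import Data.Nat.Divisibility as ND
  open import Data.Nat.Primality using (Prime; euclidsLemma; ¬prime[0]; ¬prime[1])
  open import Data.Integer as ℤ using (+_; _+_; _*_; _-_; -_)
  import Data.Integer.Properties as ℤP
  open import Data.Integer.Divisibility.Signed using (_∣_)
  open import Data.Integer.Tactic.RingSolver using (solve-∀)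
  open import Data.Rational.Unnormalised as Q using (ℚᵘ; mkℚᵘ; _≃_; *≡*)
  import Data.Rational.Unnormalised.Properties as QP
  open import Data.List as L using ([]; _∷_; [_]; _++_; upTo; map)
  import Data.List.Properties as LP
  open import Data.Vec as V using (Vec; _∷_; [])
  open import Data.Product using (_,_)
  open import Data.Sum using (inj₁; inj₂)
  open import Data.Empty using (⊥-elim)
  open import Relation.Binary.PropositionalEquality hiding ([_])
  open import Relation.Nullary using (¬_)
  open BooleanFacts
  open PartitionCounting using (stirlingR-above)
  open Congruences using (divides-difference)
  open HornerSums
  open StirlingTransforms

  -- Σ_{i < b} F i, the shape of sumFromTo 1 b after reindexing
  sumQ : ℕ → (ℕ → ℚᵘ) → ℚᵘ
  sumQ b F = L.foldr Q._+_ Q.0ℚᵘ (map F (upTo b))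

  sumQ-suc : ∀ b F → sumQ (suc b) F ≡ sumQ b F Q.+ F b
  sumQ-suc b F = trans (cong (λ z → L.foldr Q._+_ Q.0ℚᵘ (map F z)) (sym (LP.upTo-∷ʳ b)))
    (trans (cong (L.foldr Q._+_ Q.0ℚᵘ) (LP.map-++ F (upTo b) [ b ])) (foldr-snoc (map F (upTo b)) (F b)))
    where
    foldr-snoc : ∀ xs y → L.foldr Q._+_ Q.0ℚᵘ (xs ++ [ y ]) ≡ L.foldr Q._+_ Q.0ℚᵘ xs Q.+ y
    foldr-snoc [] y = trans (QP.+-identityʳ-≡ y) (sym (QP.+-identityˡ-≡ y))
    foldr-snoc (x ∷ xs) y = trans (cong (x Q.+_) (foldr-snoc xs y)) (sym (QP.+-assoc-≡ x _ y))

  add-over-multiple : ∀ H s B d d′ k → suc d′ ≡ suc d ℕ.* k →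
    (mkℚᵘ H d Q.+ (mkℚᵘ s d′ Q.* mkℚᵘ (+ B) 0)) ≃ mkℚᵘ (+ k * H + s * + B) d′
  add-over-multiple H s B d d′ k e = *≡* (begin
    (H * + (suc d′ ℕ.* 1) + s * + B * + suc d) * + suc d′
      ≡⟨ cong₂ (λ u v → (H * u + s * + B * + suc d) * v) e₁ e₂ ⟩
    (H * (+ suc d * + k) + s * + B * + suc d) * (+ suc d * + k)
      ≡⟨ collect H s (+ B) (+ suc d) (+ k) ⟩
    (+ k * H + s * + B) * (+ suc d * (+ suc d * + k))
      ≡⟨ cong ((+ k * H + s * + B) *_) (sym e₃) ⟩
    (+ k * H + s * + B) * + (suc d ℕ.* (suc d′ ℕ.* 1)) ∎)
    where
    open ≡-Reasoning
    e₂ : + suc d′ ≡ + suc d * + k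
    e₂ = trans (cong +_ e) (ℤP.pos-* (suc d) k)
    e₁ : + (suc d′ ℕ.* 1) ≡ + suc d * + k
    e₁ = trans (cong +_ (ℕP.*-identityʳ (suc d′))) e₂
    e₃ : + (suc d ℕ.* (suc d′ ℕ.* 1)) ≡ + suc d * (+ suc d * + k)
    e₃ = trans (ℤP.pos-* (suc d) (suc d′ ℕ.* 1)) (cong (+ suc d *_) e₁)
    collect : ∀ H s B D K → (H * (D * K) + s * B * D) * (D * K) ≡ (K * H + s * B) * (D * (D * K))
    collect = solve-∀

  suc-pred-pow : ∀ m′ e → suc (suc m′ ℕ.^ e ℕ.∸ 1) ≡ suc m′ ℕ.^ e
  suc-pred-pow m′ e with suc m′ ℕ.^ e | ℕP.m^n>0 (suc m′) e
  ... | suc x | _ = refl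

  horner-as-fraction : ∀ m′ b (B : ℕ → ℕ) →
    sumQ b (λ i → invNegPow (suc m′) (suc i) Q.* ℕtoℚ (B (suc i)))
      ≃ mkℚᵘ (horner (+ suc m′) b (λ k → + B k)) (suc m′ ℕ.^ b ℕ.∸ 1)
  horner-as-fraction m′ zero B = QP.≃-refl
  horner-as-fraction m′ (suc b) B =
    QP.≃-trans (QP.≃-reflexive (sumQ-suc b _))
      (QP.≃-trans (QP.+-congˡ _ (horner-as-fraction m′ b B))
        (add-over-multiple (horner (+ suc m′) b (λ k → + B k)) (sign (suc b)) (B (suc b))
                           (suc m′ ℕ.^ b ℕ.∸ 1) (suc m′ ℕ.^ suc b ℕ.∸ 1) (suc m′) e))
    where
    e : suc (suc m′ ℕ.^ suc b ℕ.∸ 1) ≡ suc (suc m′ ℕ.^ b ℕ.∸ 1) ℕ.* suc m′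
    e = trans (suc-pred-pow m′ (suc b)) (trans (ℕP.*-comm (suc m′) _) (cong (ℕ._* suc m′) (sym (suc-pred-pow m′ b))))

  pos-pow : ∀ a e → + (a ℕ.^ e) ≡ powℤ (+ a) e
  pos-pow a zero = refl
  pos-pow a (suc e) = trans (ℤP.pos-* a (a ℕ.^ e)) (cong (+ a *_) (pos-pow a e))

  prime∤pow : ∀ {p} → Prime p → ∀ m → ¬ (p ND.∣ m) → ∀ e → ¬ (p ND.∣ (m ℕ.^ e))
  prime∤pow {suc (suc p)} pr m p∤m zero h with ND.∣⇒≤ h
  ... | s≤s ()
  prime∤pow pr m p∤m (suc e) h with euclidsLemma m (m ℕ.^ e) pr h
  ... | inj₁ p∣m = p∤m p∣m
  ... | inj₂ p∣mᵉ = prime∤pow pr m p∤m e p∣mᵉ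

  last≤sum : ∀ {q′} (rs : Vec ℕ (suc q′)) → V.last rs ≤ V.sum rs
  last≤sum (r ∷ []) = ℕP.m≤m+n r 0
  last≤sum (r ∷ r′ ∷ rs) = ℕP.≤-trans (last≤sum (r′ ∷ rs)) (ℕP.m≤n+m _ r)

  -- the coefficientwise congruence for the prime p = b′ + 2 and m = m′ + 1 ≥ 1
  module _ (n m′ b′ : ℕ) (pr : Prime (suc (suc b′))) (p∤m : ¬ (suc (suc b′) ND.∣ suc m′))
           {q′ : ℕ} (rs : Vec ℕ (suc q′)) where

    open IntegerForm.Parameters n (suc m′) b′ pr p∤m rs

    r-last : ℕ
    r-last = V.last rs
    d : ℕ
    d = suc m′ ℕ.^ b ℕ.∸ 1     -- the denominator M^{p-1} is suc d

    Fr-coefficient : ∀ N j → r-last ≤ j → Fr N rs (j ℕ.∸ r-last) ≡ ℕtoℚ (stirlingR rs-list (N ℕ.+ total) j ℕ.* j !)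
    Fr-coefficient N j r≤j with (j ℕ.∸ r-last) ≤ᵇ (N ℕ.+ (total ℕ.∸ r-last)) in e
    ... | true = cong (λ z → ℕtoℚ (stirlingR rs-list (N ℕ.+ total) z ℕ.* z !)) (ℕP.m∸n+n≡m r≤j)
    ... | false = sym (cong (λ z → ℕtoℚ (z ℕ.* j !)) (stirlingR-above rs-list (N ℕ.+ total) j too-many))
      where
      too-many : N ℕ.+ total < j
      too-many = subst₂ _<_ (trans (ℕP.+-assoc N _ r-last) (cong (N ℕ.+_) (ℕP.m∸n+n≡m (last≤sum rs))))
                            (ℕP.m∸n+n≡m r≤j) (ℕP.+-monoˡ-< r-last (≤ᵇ-false _ _ e))

    lhs-coefficient : ∀ j → shiftX r-last (sumOverNegPow p (suc m′) (λ k → Fr (n ℕ.+ k) rs)) j ≃ mkℚᵘ (lhsVector j) d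
    lhs-coefficient j with j <ᵇ r-last in e
    ... | true = subst (λ z → Q.0ℚᵘ ≃ mkℚᵘ z d)
                   (sym (horner-vanish M b _ (λ k → cong (λ z → + (z ℕ.* j !)) (stirlingR-below-last rs (n ℕ.+ k) j (<ᵇ-true j r-last e)))))
                   (*≡* refl)
    ... | false = QP.≃-trans
          (QP.≃-reflexive (cong (L.foldr Q._+_ Q.0ℚᵘ)
            (LP.map-cong (λ i → cong (invNegPow (suc m′) (suc i) Q.*_) (Fr-coefficient (n ℕ.+ suc i) j (<ᵇ-false j r-last e))) (upTo b))))
          (horner-as-fraction m′ b (λ k → stirlingR rs-list ((n ℕ.+ k) ℕ.+ total) j ℕ.* j !))

    calF-coefficient : ∀ j → calF b (suc m′) 0 j ≡ ℕtoℚ (stirlingR [ suc m′ ] (b ℕ.+ suc m′) (j ℕ.+ suc m′) ℕ.* j !)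
    calF-coefficient j with j ≤ᵇ b in e
    ... | true = cong (λ z → ℕtoℚ (stirlingR [ suc m′ ] (b ℕ.+ suc m′) (j ℕ.+ suc m′) ℕ.* z !)) (ℕP.+-identityʳ j)
    ... | false rewrite stirlingR-above [ suc m′ ] (b ℕ.+ suc m′) (j ℕ.+ suc m′) (ℕP.+-monoˡ-< (suc m′) (≤ᵇ-false j b e)) = refl

    minusOne-coefficient : ∀ j → minusOne (calF b (suc m′) 0) j ≃ mkℚᵘ (mStirlingVector (suc m′) b j - unit j) 0
    minusOne-coefficient zero = QP.≃-trans (QP.≃-reflexive (cong (Q._- Q.1ℚᵘ) (calF-coefficient 0))) (*≡* (subtract-one (mStirlingVector (suc m′) b 0)))
      where
      subtract-one : ∀ x → (x * + 1 + (- + 1) * + 1) * + 1 ≡ (x - + 1) * + 1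
      subtract-one = solve-∀
    minusOne-coefficient (suc j) = QP.≃-trans (QP.≃-reflexive (calF-coefficient (suc j)))
      (*≡* (cong (_* + 1) (sym (ℤP.+-identityʳ (mStirlingVector (suc m′) b (suc j))))))

    rhs-coefficient : ∀ j → scalePoly (ℤtoℚ C) (minusOne (calF (p ℕ.∸ 1) (suc m′) 0)) j ≃ mkℚᵘ (C * (mStirlingVector (suc m′) b j - unit j)) 0
    rhs-coefficient j = QP.≃-trans (QP.*-congˡ {ℤtoℚ C} (minusOne-coefficient j)) (*≡* refl)

    subtract-integer : ∀ X d Y → (mkℚᵘ X d Q.- mkℚᵘ Y 0) ≃ mkℚᵘ (X - Y * + suc d) d
    subtract-integer X d Y = *≡* (trans (distribute X Y (+ suc d)) (cong ((X - Y * + suc d) *_) (cong +_ (sym (ℕP.*-identityʳ (suc d))))))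
      where
      distribute : ∀ X Y D → (X * + 1 + (- Y) * D) * D ≡ (X - Y * D) * D
      distribute = solve-∀

    denominator : + suc d ≡ D
    denominator = trans (cong +_ (suc-pred-pow m′ b)) (pos-pow (suc m′) b)

    coefficient-congruence : ∀ j → shiftX r-last (sumOverNegPow p (suc m′) (λ k → Fr (n ℕ.+ k) rs)) j
                                     ≡[mod p ] scalePoly (ℤtoℚ C) (minusOne (calF (p ℕ.∸ 1) (suc m′) 0)) j
    coefficient-congruence j = _∣_.quotient p∣diff , d , p∤denominator , difference
      where
      p∣diff : + p ∣ (lhsVector j - rhsVector j)
      p∣diff = divides-difference (vectors-agree j)
      p∤denominator : ¬ (p ND.∣ suc d)
      p∤denominator h = prime∤pow pr (suc m′) p∤m b (subst (p ND.∣_) (suc-pred-pow m′ b) h)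
      difference = QP.≃-trans (QP.+-cong (lhs-coefficient j) (QP.-‿cong (rhs-coefficient j)))
        (QP.≃-trans (subtract-integer (lhsVector j) d (C * (mStirlingVector (suc m′) b j - unit j)))
          (QP.≃-reflexive (cong (λ z → mkℚᵘ z d)
            (trans (cong (λ z → lhsVector j - C * (mStirlingVector (suc m′) b j - unit j) * z) denominator)
                   (trans (_∣_.equality p∣diff) (ℤP.*-comm (_∣_.quotient p∣diff) (+ p)))))))

  congruence : ∀ (n m p : ℕ) → Prime p → ¬ (p ND.∣ m) → ∀ {q′ : ℕ} (rs : Vec ℕ (suc q′)) →
      shiftX (V.last rs) (sumOverNegPow p m (λ k → Fr (n ℕ.+ k) rs))
        ≡ₚ[mod p ]
      scalePoly (ℤtoℚ (powℤ (ℤ.- (+ m)) n ℤ.* prodFalling (ℤ.- (+ m)) rs)) (minusOne (calF (p ℕ.∸ 1) m 0))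
  congruence n m zero pr = ⊥-elim (¬prime[0] pr)
  congruence n m (suc zero) pr = ⊥-elim (¬prime[1] pr)
  congruence n zero (suc (suc b′)) pr p∤m = ⊥-elim (p∤m (ND._∣0 (suc (suc b′))))
  congruence n (suc m′) (suc (suc b′)) pr p∤m rs = coefficient-congruence n m′ b′ pr p∤m rs

module SingleSet where

  open import Defs
  open import Data.Bool using (if_then_else_)
  open import Data.Nat as ℕ using (suc)
  import Data.Nat.Properties as ℕP
  import Data.Integer as ℤ
  import Data.Integer.Properties as ℤP
  open import Data.List as L using (upTo)
  import Data.List.Properties as LP
  open import Data.Vec using (_∷_; [])
  import Data.Rational.Unnormalised as Q
  open import Relation.Binary.PropositionalEquality

  Fr-single : ∀ N r j → Fr N (r ∷ []) j ≡ calF N r r j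
  Fr-single N r j rewrite ℕP.+-identityʳ r | ℕP.n∸n≡0 r | ℕP.+-identityʳ N = refl

  lhs-single : ∀ n p m r j → shiftX r (sumOverNegPow p m (λ k → Fr (n ℕ.+ k) (r ∷ []))) j
                            ≡ shiftX r (sumOverNegPow p m (λ k → calF (n ℕ.+ k) r r)) j
  lhs-single n p m r j = cong (λ z → if j ℕ.<ᵇ r then Q.0ℚᵘ else z)
    (cong (L.foldr Q._+_ Q.0ℚᵘ)
      (LP.map-cong (λ i → cong (invNegPow m (suc i) Q.*_) (Fr-single (n ℕ.+ suc i) r (j ℕ.∸ r))) (upTo (p ℕ.∸ 1))))

  rhs-single : ∀ c α r → c ℤ.* prodFalling α (r ∷ []) ≡ c ℤ.* falling α r
  rhs-single c α r = cong (c ℤ.*_) (ℤP.*-identityʳ (falling α r))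

open import Defs
open import Data.Nat using (ℕ; suc; _+_; _∸_)
open import Data.Nat.Divisibility using (_∣_)
open import Data.Nat.Primality using (Prime)
open import Data.Integer as ℤ using (+_)
open import Data.Vec using (Vec; last; _∷_; [])
open import Data.Product using (_×_; _,_)
open import Relation.Nullary using (¬_)
open import Relation.Binary.PropositionalEquality using (subst₂; cong)

proposition14 : (n m p : ℕ) → Prime p → ¬ (p ∣ m) →
    ((q' : ℕ) (rs : Vec ℕ (suc q')) → Nondecreasing rs →
    shiftX (last rs) (sumOverNegPow p m (λ k → Fr (n + k) rs))
    ≡ₚ[mod p ]
    scalePoly (ℤtoℚ (powℤ (ℤ.- (+ m)) n ℤ.* prodFalling (ℤ.- (+ m)) rs)) (minusOne (calF (p ∸ 1) m 0)))
    ×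
    ((r : ℕ) →
    shiftX r (sumOverNegPow p m (λ k → calF (n + k) r r))
    ≡ₚ[mod p ]
    scalePoly (ℤtoℚ (powℤ (ℤ.- (+ m)) n ℤ.* falling (ℤ.- (+ m)) r)) (minusOne (calF (p ∸ 1) m 0)))
proposition14 n m p pr p∤m = (λ q′ rs _ → general rs) , single
  where
  general : ∀ {q′} (rs : Vec ℕ (suc q′)) →
    shiftX (last rs) (sumOverNegPow p m (λ k → Fr (n + k) rs))
    ≡ₚ[mod p ] scalePoly (ℤtoℚ (powℤ (ℤ.- (+ m)) n ℤ.* prodFalling (ℤ.- (+ m)) rs)) (minusOne (calF (p ∸ 1) m 0))
  general = RationalForm.congruence n m p pr p∤m
  single : ∀ r →
    shiftX r (sumOverNegPow p m (λ k → calF (n + k) r r))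
    ≡ₚ[mod p ] scalePoly (ℤtoℚ (powℤ (ℤ.- (+ m)) n ℤ.* falling (ℤ.- (+ m)) r)) (minusOne (calF (p ∸ 1) m 0))
  single r j = subst₂ (λ a c → a ≡[mod p ] c)
    (SingleSet.lhs-single n p m r j)
    (cong (λ z → scalePoly (ℤtoℚ z) (minusOne (calF (p ∸ 1) m 0)) j) (SingleSet.rhs-single (powℤ (ℤ.- (+ m)) n) (ℤ.- (+ m)) r))
    (general (r ∷ []) j)
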